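{- Let $P$ be a finite projective plane and $M_P$ the corresponding matroid. The class of finite simple $\wedge$-matroids $N$ of rank $\leq 3$ omitting $M_P$ is a Fraïssé class (closed under isomorphism and substructures, with the joint embedding and amalgamation properties).
   Context: A simple matroid of rank $\leq 3$ is a $3$-hypergraph $(V,R)$ with $R$ irreflexive and symmetric such that $R(a,b,c)$ and $R(a,b,d)$ imply every $3$-subset of $\{a,b,c,d\}$ is in $R$. Lines are $a\vee b:=\{a,b\}\cup\{c:R(a,b,c)\}$ for $a\neq b$. A simple $\wedge$-matroid of rank $\leq 3$ is $(V,R,\wedge)$ with $\wedge(a,b,c,d)=p$ if $a\neq b$, $c\neq d$, the lines $a\vee b\ne c\vee d$ meet in a point $p\notin\{a,b,c,d\}$, and $\wedge(a,b,c,d)=a$ otherwise; substructures and embeddings are in the language $\{R,\wedge\}$. A projective plane is a linear space (points and lines, any two distinct points on a unique line, every line with at least two points) in which any two distinct lines meet in exactly one point and there are four points no three collinear. $M_P$ is the matroid on the points of $P$ whose $R$-triples are triples of distinct collinear points. $N$ omits $M_P$ if there is no injective map $f:M_P\to N$ with $M_P\cong f(M_P)$, i.e. no subset of $N$ induces a $3$-hypergraph isomorphic to $M_P$. -}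

module Defs where

open import Data.Nat using (ℕ)
open import Data.Fin using (Fin)
open import Data.Bool using (Bool; true; false)
open import Data.Product using (Σ; ∃; _×_; _,_)
open import Data.Sum using (_⊎_)
open import Data.Empty using (⊥)
open import Relation.Nullary using (¬_)
open import Relation.Binary.PropositionalEquality using (_≡_; _≢_)
open import Function.Definitions using (Injective)
open import Function.Bundles using (_⇔_)

-- Finite simple matroids of rank ≤ 3 (3-hypergraphs) on Fin n.
-- The relation R is Bool-valued (decidable), as fits finite structures.

module _ {n : ℕ} (R : Fin n → Fin n → Fin n → Bool) where

  OnLine : Fin n → Fin n → Fin n → Set
  OnLine a b x = x ≡ a ⊎ x ≡ b ⊎ R a b x ≡ true

  SameLine : Fin n → Fin n → Fin n → Fin n → Set
  SameLine a b c d = ∀ x → OnLine a b x ⇔ OnLine c d x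

  MeetCond : Fin n → Fin n → Fin n → Fin n → Fin n → Set
  MeetCond a b c d p =
    a ≢ b × c ≢ d × ¬ SameLine a b c d ×
    OnLine a b p × OnLine c d p ×
    p ≢ a × p ≢ b × p ≢ c × p ≢ d

record ∧Matroid (n : ℕ) : Set where
  field
    R     : Fin n → Fin n → Fin n → Bool
    meet  : Fin n → Fin n → Fin n → Fin n → Fin n
    irrefl : ∀ a b c → R a b c ≡ true → a ≢ b × a ≢ c × b ≢ c
    -- symmetric (these two transpositions generate all permutations)
    sym₁₂  : ∀ a b c → R a b c ≡ R b a c
    sym₂₃  : ∀ a b c → R a b c ≡ R a c b
    -- R(a,b,c) and R(a,b,d) imply every 3-subset of {a,b,c,d} is in R
    -- (when c = d the only 3-subset is {a,b,c}; when c ≠ d the new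
    --  3-subsets are {a,c,d} and {b,c,d})
    exch   : ∀ a b c d → R a b c ≡ true → R a b d ≡ true → c ≢ d →
             R a c d ≡ true × R b c d ≡ true
    meet-spec : ∀ a b c d →
      MeetCond R a b c d (meet a b c d)
      ⊎ ((¬ Σ (Fin n) (MeetCond R a b c d)) × meet a b c d ≡ a)

open ∧Matroid public

record IsEmbedding {m n : ℕ} (M : ∧Matroid m) (N : ∧Matroid n)
                   (f : Fin m → Fin n) : Set where
  field
    injective : Injective _≡_ _≡_ f
    pres-R    : ∀ a b c → R M a b c ≡ R N (f a) (f b) (f c)
    pres-meet : ∀ a b c d → f (meet M a b c d) ≡ meet N (f a) (f b) (f c) (f d)

Embedding : {m n : ℕ} → ∧Matroid m → ∧Matroid n → Set
Embedding {m} {n} M N = Σ (Fin m → Fin n) (IsEmbedding M N)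

Isomorphism : {m n : ℕ} → ∧Matroid m → ∧Matroid n → Set
Isomorphism M N = Σ (Embedding M N) λ { (f , _) → ∀ y → ∃ λ x → f x ≡ y }

record ProjectivePlane (p l : ℕ) : Set where
  field
    I : Fin p → Fin l → Bool
    join      : ∀ x y → x ≢ y → Σ (Fin l) λ L → I x L ≡ true × I y L ≡ true
    join-uniq : ∀ x y → x ≢ y → ∀ L L' →
                I x L ≡ true → I y L ≡ true →
                I x L' ≡ true → I y L' ≡ true → L ≡ L'
    two-points : ∀ L → Σ (Fin p) λ x → Σ (Fin p) λ y →
                 x ≢ y × I x L ≡ true × I y L ≡ true
    cross      : ∀ L L' → L ≢ L' → Σ (Fin p) λ x → I x L ≡ true × I x L' ≡ true
    cross-uniq : ∀ L L' → L ≢ L' → ∀ x y →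
                 I x L ≡ true → I x L' ≡ true →
                 I y L ≡ true → I y L' ≡ true → x ≡ y
    quad : Σ (Fin 4 → Fin p) λ q → Injective _≡_ _≡_ q ×
           (∀ i j k → i ≢ j → i ≢ k → j ≢ k →
              ¬ Σ (Fin l) λ L → I (q i) L ≡ true × I (q j) L ≡ true × I (q k) L ≡ true)

open ProjectivePlane public

R-MP : {p l : ℕ} → ProjectivePlane p l → Fin p → Fin p → Fin p → Set
R-MP {p} {l} P x y z =
  x ≢ y × x ≢ z × y ≢ z ×
  Σ (Fin l) λ L → I P x L ≡ true × I P y L ≡ true × I P z L ≡ true

Omits : {p l n : ℕ} → ProjectivePlane p l → ∧Matroid n → Set
Omits {p} {l} {n} P N =
  ¬ Σ (Fin p → Fin n) λ f → Injective _≡_ _≡_ f ×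
      (∀ x y z → R-MP P x y z ⇔ (R N (f x) (f y) (f z) ≡ true))

Class : Set₁
Class = ∀ {n} → ∧Matroid n → Set

IsoClosed : Class → Set
IsoClosed K = ∀ {m n} (M : ∧Matroid m) (N : ∧Matroid n) →
  Isomorphism M N → K N → K M

SubstructureClosed : Class → Set
SubstructureClosed K = ∀ {m n} (N : ∧Matroid n) (ι : Fin m → Fin n) →
  K N → Injective _≡_ _≡_ ι →
  (∀ a b c d → ∃ λ e → ι e ≡ meet N (ι a) (ι b) (ι c) (ι d)) →
  Σ (∧Matroid m) λ M → IsEmbedding M N ι × K M

JEP : Class → Set
JEP K = ∀ {m n} (A : ∧Matroid m) (B : ∧Matroid n) → K A → K B →
  Σ ℕ λ k → Σ (∧Matroid k) λ C → K C × Embedding A C × Embedding B C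

AP : Class → Set
AP K = ∀ {a b c} (A : ∧Matroid a) (B : ∧Matroid b) (C : ∧Matroid c) →
  K A → K B → K C →
  (f : Fin a → Fin b) → IsEmbedding A B f →
  (g : Fin a → Fin c) → IsEmbedding A C g →
  Σ ℕ λ d → Σ (∧Matroid d) λ D → K D ×
    Σ (Fin b → Fin d) λ f' → Σ (Fin c → Fin d) λ g' →
      IsEmbedding B D f' × IsEmbedding C D g' × (∀ x → f' (f x) ≡ g' (g x))

record FraisseClass (K : Class) : Set where
  field
    iso-closed : IsoClosed K
    sub-closed : SubstructureClosed K
    jep        : JEP K
    ap         : AP K

-- Omitting M_P is inherited along any R-preserving injection, which gives closure under isomorphism
-- and under ∧-substructures; joint embedding is amalgamation over the empty structure.
-- For amalgamation, B and C are glued freely along A: the collinear triples of the amalgam are those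
-- on a line of B, on a line of C, or on the union of the B- and C-lines through two points of A.
-- Since the embeddings of A preserve ∧, two A-lines whose images meet outside the image of A
-- coincide; this makes the free amalgam a simple matroid containing B and C as ∧-substructures.
-- A copy of M_P in the amalgam lies inside B or inside C: otherwise it has a point x₀ outside B and
-- a point y₀ outside C, and four further points of the plane, all forced into A, make y₀ collinear
-- with two of them that are not collinear with y₀ in P.

module Submission where

open import Defs
open import Data.Nat using (ℕ; _+_)
open import Data.Fin using (Fin; zero; suc; _≟_; splitAt) renaming (join to joinFin)
open import Data.Fin.Properties using (any?; all?; ¬∀⟶∃¬; splitAt-join; join-splitAt)
open import Data.Bool using (Bool; true; false)
open import Data.Bool.Properties using () renaming (_≟_ to _≟ᴮ_)
open import Data.Maybe using (Maybe; just; nothing; Is-just)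
open import Data.Maybe.Properties using (just-injective)
open import Data.Maybe.Relation.Unary.Any as Any using (Any; just)
open import Data.Product using (Σ; ∃; _×_; _,_; proj₁; proj₂)
open import Data.Sum using (_⊎_; inj₁; inj₂; swap; [_,_]′)
open import Data.Sum.Properties using (≡-dec)
open import Data.Empty using (⊥; ⊥-elim)
open import Data.Unit using (tt)
open import Relation.Nullary using (¬_; Dec; yes; no; does; contradiction)
open import Relation.Nullary.Decidable using (_×-dec_; _⊎-dec_; _→-dec_; ¬?; map′; dec-true; does-⇔)
open import Relation.Binary.Definitions using (DecidableEquality)
open import Relation.Binary.PropositionalEquality using (_≡_; _≢_; refl; sym; trans; cong; subst; module ≡-Reasoning)
open import Function.Definitions using (Injective)
open import Function.Base using (_∘′_)
open import Function.Bundles using (_⇔_; mk⇔; Equivalence)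

Ternary : ℕ → Set
Ternary n = Fin n → Fin n → Fin n → Bool

-- Lines of a simple matroid of rank ≤ 3

SubLine : ∀ {n} → Ternary n → Fin n → Fin n → Fin n → Fin n → Set
SubLine R a b c d = ∀ x → OnLine R a b x → OnLine R c d x

EqLine : ∀ {n} → Ternary n → Fin n → Fin n → Fin n → Fin n → Set
EqLine R a b c d = SubLine R a b c d × SubLine R c d a b

eqLine⇒sameLine : ∀ {n} {R : Ternary n} {a b c d} → EqLine R a b c d → SameLine R a b c d
eqLine⇒sameLine (p , q) x = mk⇔ (p x) (q x)

sameLine⇒eqLine : ∀ {n} {R : Ternary n} {a b c d} → SameLine R a b c d → EqLine R a b c d
sameLine⇒eqLine s = (λ x → Equivalence.to (s x)) , (λ x → Equivalence.from (s x))

module Lines {n : ℕ} (R : Ternary n)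
  (R-irrefl : ∀ a b c → R a b c ≡ true → a ≢ b × a ≢ c × b ≢ c)
  (R-sym₁₂ : ∀ a b c → R a b c ≡ R b a c)
  (R-sym₂₃ : ∀ a b c → R a b c ≡ R a c b)
  (R-exch : ∀ a b c d → R a b c ≡ true → R a b d ≡ true → c ≢ d →
            R a c d ≡ true × R b c d ≡ true) where

  Triple : Fin n → Fin n → Fin n → Set
  Triple a b c = R a b c ≡ true

  triple-swap₁₂ : ∀ {a b c} → Triple a b c → Triple b a c
  triple-swap₁₂ {a} {b} {c} t = trans (sym (R-sym₁₂ a b c)) t

  triple-swap₂₃ : ∀ {a b c} → Triple a b c → Triple a c b
  triple-swap₂₃ {a} {b} {c} t = trans (sym (R-sym₂₃ a b c)) t

  triple-rotate : ∀ {a b c} → Triple a b c → Triple b c a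
  triple-rotate t = triple-swap₂₃ (triple-swap₁₂ t)

  OnL : Fin n → Fin n → Fin n → Set
  OnL = OnLine R

  onLine-left : ∀ {a b} → OnL a b a
  onLine-left = inj₁ refl

  onLine-right : ∀ {a b} → OnL a b b
  onLine-right = inj₂ (inj₁ refl)

  onLine-sym : ∀ {a b x} → OnL a b x → OnL b a x
  onLine-sym (inj₁ e)        = inj₂ (inj₁ e)
  onLine-sym (inj₂ (inj₁ e)) = inj₁ e
  onLine-sym (inj₂ (inj₂ t)) = inj₂ (inj₂ (triple-swap₁₂ t))

  onLine-degenerate : ∀ {a x} → OnL a a x → x ≡ a
  onLine-degenerate (inj₁ e)        = e
  onLine-degenerate (inj₂ (inj₁ e)) = e
  onLine-degenerate {a} {x} (inj₂ (inj₂ t)) = ⊥-elim (proj₁ (R-irrefl a a x t) refl)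

  eqLine-refl : ∀ {a b} → EqLine R a b a b
  eqLine-refl = (λ _ o → o) , (λ _ o → o)

  eqLine-sym : ∀ {a b c d} → EqLine R a b c d → EqLine R c d a b
  eqLine-sym (p , q) = q , p

  eqLine-trans : ∀ {a b c d e f} → EqLine R a b c d → EqLine R c d e f → EqLine R a b e f
  eqLine-trans (p , q) (r , s) = (λ x o → r x (p x o)) , (λ x o → q x (s x o))

  eqLine-swap : ∀ {a b} → EqLine R a b b a
  eqLine-swap = (λ _ → onLine-sym) , (λ _ → onLine-sym)

  triple⇒subLine : ∀ {a b c} → Triple a b c → SubLine R a b a c
  triple⇒subLine t x (inj₁ e) = inj₁ e
  triple⇒subLine t x (inj₂ (inj₁ refl)) = inj₂ (inj₂ (triple-swap₂₃ t))
  triple⇒subLine {a} {b} {c} t x (inj₂ (inj₂ u)) with x ≟ c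
  ... | yes e = inj₂ (inj₁ e)
  ... | no x≢c = inj₂ (inj₂ (proj₁ (R-exch a b c x t u (λ e → x≢c (sym e)))))

  eqLine-rebase : ∀ {a b p} → OnL a b p → p ≢ a → EqLine R a b a p
  eqLine-rebase (inj₁ e) p≢a = ⊥-elim (p≢a e)
  eqLine-rebase (inj₂ (inj₁ refl)) p≢a = eqLine-refl
  eqLine-rebase (inj₂ (inj₂ t)) p≢a = triple⇒subLine t , triple⇒subLine (triple-swap₂₃ t)

  eqLine-through : ∀ {a b p q} → OnL a b p → OnL a b q → p ≢ q → EqLine R a b p q
  eqLine-through {a} {b} {p} {q} op oq p≢q with p ≟ a
  ... | yes refl = eqLine-rebase oq (λ e → p≢q (sym e))
  ... | no p≢a = eqLine-trans ab=pa (eqLine-rebase (proj₁ ab=pa q oq) (λ e → p≢q (sym e)))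
    where
    ab=pa : EqLine R a b p a
    ab=pa = eqLine-trans (eqLine-rebase op p≢a) eqLine-swap

  onLine⇒triple : ∀ {a b x y z} → OnL a b x → OnL a b y → OnL a b z →
                  x ≢ y → x ≢ z → y ≢ z → Triple x y z
  onLine⇒triple ox oy oz x≢y x≢z y≢z with proj₁ (eqLine-through ox oy x≢y) _ oz
  ... | inj₁ e        = ⊥-elim (x≢z (sym e))
  ... | inj₂ (inj₁ e) = ⊥-elim (y≢z (sym e))
  ... | inj₂ (inj₂ t) = t

  triple? : ∀ a b c → Dec (Triple a b c)
  triple? a b c = R a b c ≟ᴮ true

  onLine? : ∀ a b x → Dec (OnL a b x)
  onLine? a b x = (x ≟ a) ⊎-dec (x ≟ b) ⊎-dec triple? a b x

  sameLine? : ∀ a b c d → Dec (SameLine R a b c d)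
  sameLine? a b c d = all? (λ x → onLine? a b x ⇔? onLine? c d x)
    where
    _⇔?_ : ∀ {A B : Set} → Dec A → Dec B → Dec (A ⇔ B)
    a? ⇔? b? = map′ (λ (f , g) → mk⇔ f g) (λ e → Equivalence.to e , Equivalence.from e)
                    ((a? →-dec b?) ×-dec (b? →-dec a?))

  meetCond? : ∀ a b c d p → Dec (MeetCond R a b c d p)
  meetCond? a b c d p =
    ¬? (a ≟ b) ×-dec ¬? (c ≟ d) ×-dec ¬? (sameLine? a b c d) ×-dec
    onLine? a b p ×-dec onLine? c d p ×-dec
    ¬? (p ≟ a) ×-dec ¬? (p ≟ b) ×-dec ¬? (p ≟ c) ×-dec ¬? (p ≟ d)

  meetCond-unique : ∀ {a b c d p q} → MeetCond R a b c d p → MeetCond R a b c d q → p ≡ q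
  meetCond-unique {p = p} {q} (_ , _ , ab≠cd , abp , cdp , _) (_ , _ , _ , abq , cdq , _) with p ≟ q
  ... | yes p≡q = p≡q
  ... | no p≢q = ⊥-elim (ab≠cd (eqLine⇒sameLine
          (eqLine-trans (eqLine-through abp abq p≢q) (eqLine-sym (eqLine-through cdp cdq p≢q)))))

  meetOf : Fin n → Fin n → Fin n → Fin n → Fin n
  meetOf a b c d with any? (meetCond? a b c d)
  ... | yes (p , _) = p
  ... | no _ = a

  meetOf-spec : ∀ a b c d → MeetCond R a b c d (meetOf a b c d)
    ⊎ ((¬ Σ (Fin n) (MeetCond R a b c d)) × meetOf a b c d ≡ a)
  meetOf-spec a b c d with any? (meetCond? a b c d)
  ... | yes (_ , m) = inj₁ m
  ... | no ¬m = inj₂ (¬m , refl)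

  matroid : ∧Matroid n
  matroid = record
    { R = R ; meet = meetOf ; irrefl = R-irrefl ; sym₁₂ = R-sym₁₂ ; sym₂₃ = R-sym₂₃
    ; exch = R-exch ; meet-spec = meetOf-spec }

module MatroidLines {n : ℕ} (M : ∧Matroid n) = Lines (R M) (irrefl M) (sym₁₂ M) (sym₂₃ M) (exch M)

meet-≡ : ∀ {n} (M : ∧Matroid n) {a b c d p} → MeetCond (R M) a b c d p → meet M a b c d ≡ p
meet-≡ M {a} {b} {c} {d} m with meet-spec M a b c d
... | inj₁ m' = MatroidLines.meetCond-unique M m' m
... | inj₂ (¬m , _) = ⊥-elim (¬m (_ , m))

meet-≡-first : ∀ {n} (M : ∧Matroid n) {a b c d} → ¬ Σ (Fin n) (MeetCond (R M) a b c d) →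
               meet M a b c d ≡ a
meet-≡-first M {a} {b} {c} {d} ¬m with meet-spec M a b c d
... | inj₁ m = ⊥-elim (¬m (_ , m))
... | inj₂ (_ , e) = e

-- Copies of M_P

PreservesR : ∀ {m n} → ∧Matroid m → ∧Matroid n → (Fin m → Fin n) → Set
PreservesR M N e = ∀ a b c → R M a b c ≡ R N (e a) (e b) (e c)

Copy : ∀ {p l n} → ProjectivePlane p l → ∧Matroid n → Set
Copy {p} {l} {n} P N = Σ (Fin p → Fin n) λ f → Injective _≡_ _≡_ f ×
  (∀ x y z → R-MP P x y z ⇔ (R N (f x) (f y) (f z) ≡ true))

module _ {p l m n} (P : ProjectivePlane p l) (M : ∧Matroid m) (N : ∧Matroid n)
         (e : Fin m → Fin n) (e-R : PreservesR M N e) where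

  copy-compose : Injective _≡_ _≡_ e → Copy P M → Copy P N
  copy-compose e-inj (G , G-inj , G-R) =
    (λ x → e (G x)) , (λ eq → G-inj (e-inj eq)) ,
    λ x y z → mk⇔ (λ r → trans (sym (e-R (G x) (G y) (G z))) (Equivalence.to (G-R x y z) r))
                  (λ t → Equivalence.from (G-R x y z) (trans (e-R (G x) (G y) (G z)) t))

  copy-factor : ((F , _) : Copy P N) (G : Fin p → Fin m) → (∀ x → F x ≡ e (G x)) → Copy P M
  copy-factor (F , F-inj , F-R) G F≡eG =
    G , (λ {x} {y} eq → F-inj (trans (F≡eG x) (trans (cong e eq) (sym (F≡eG y))))) ,
    λ x y z → mk⇔ (λ r → trans (e-R (G x) (G y) (G z)) (R-cong (Equivalence.to (F-R x y z) r)))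
                  (λ t → Equivalence.from (F-R x y z) (R-cong′ (trans (sym (e-R (G x) (G y) (G z))) t)))
    where
    R-cong : ∀ {x y z} → R N (F x) (F y) (F z) ≡ true → R N (e (G x)) (e (G y)) (e (G z)) ≡ true
    R-cong {x} {y} {z} t rewrite F≡eG x | F≡eG y | F≡eG z = t
    R-cong′ : ∀ {x y z} → R N (e (G x)) (e (G y)) (e (G z)) ≡ true → R N (F x) (F y) (F z) ≡ true
    R-cong′ {x} {y} {z} t rewrite F≡eG x | F≡eG y | F≡eG z = t

  omits-reflect : Injective _≡_ _≡_ e → Omits P N → Omits P M
  omits-reflect e-inj N-omits c = N-omits (copy-compose e-inj c)

omits-isoClosed : ∀ {p l} (P : ProjectivePlane p l) → IsoClosed (Omits P)
omits-isoClosed P M N ((f , f-emb) , _) =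
  omits-reflect P M N f (IsEmbedding.pres-R f-emb) (IsEmbedding.injective f-emb)

module AlongInjection {m n} (R₁ : Ternary m) (N : ∧Matroid n) (e : Fin m → Fin n)
  (e-inj : Injective _≡_ _≡_ e) (e-R : ∀ a b c → R₁ a b c ≡ R N (e a) (e b) (e c)) where

  private module N = MatroidLines N

  e-≢ : ∀ {a b} → a ≢ b → e a ≢ e b
  e-≢ a≢b eq = a≢b (e-inj eq)

  ≢-e : ∀ {a b} → e a ≢ e b → a ≢ b
  ≢-e ea≢eb eq = ea≢eb (cong e eq)

  triple-e : ∀ {a b c} → R₁ a b c ≡ true → R N (e a) (e b) (e c) ≡ true
  triple-e {a} {b} {c} t = trans (sym (e-R a b c)) t

  e-triple : ∀ {a b c} → R N (e a) (e b) (e c) ≡ true → R₁ a b c ≡ true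
  e-triple {a} {b} {c} t = trans (e-R a b c) t

  onLine-e : ∀ {a b x} → OnLine R₁ a b x → OnLine (R N) (e a) (e b) (e x)
  onLine-e (inj₁ eq)        = inj₁ (cong e eq)
  onLine-e (inj₂ (inj₁ eq)) = inj₂ (inj₁ (cong e eq))
  onLine-e (inj₂ (inj₂ t))  = inj₂ (inj₂ (triple-e t))

  e-onLine : ∀ {a b x} → OnLine (R N) (e a) (e b) (e x) → OnLine R₁ a b x
  e-onLine (inj₁ eq)        = inj₁ (e-inj eq)
  e-onLine (inj₂ (inj₁ eq)) = inj₂ (inj₁ (e-inj eq))
  e-onLine (inj₂ (inj₂ t))  = inj₂ (inj₂ (e-triple t))

  e-eqLine : ∀ {a b c d} → EqLine (R N) (e a) (e b) (e c) (e d) → EqLine R₁ a b c d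
  e-eqLine (p , q) = (λ x o → e-onLine (p (e x) (onLine-e o))) , (λ x o → e-onLine (q (e x) (onLine-e o)))

  eqLine-e : ∀ {a b c d} → EqLine R₁ a b c d → EqLine (R N) (e a) (e b) (e c) (e d)
  eqLine-e {a} {b} {c} {d} (p , q) with c ≟ d
  ... | no c≢d =
    N.eqLine-through (onLine-e (q c (inj₁ refl))) (onLine-e (q d (inj₂ (inj₁ refl)))) (e-≢ c≢d)
  ... | yes refl with e-inj (N.onLine-degenerate (onLine-e (p a (inj₁ refl))))
                    | e-inj (N.onLine-degenerate (onLine-e (p b (inj₂ (inj₁ refl)))))
  ...   | refl | refl = N.eqLine-refl

  e-sameLine : ∀ {a b c d} → SameLine (R N) (e a) (e b) (e c) (e d) → SameLine R₁ a b c d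
  e-sameLine s = eqLine⇒sameLine {R = R₁} (e-eqLine (sameLine⇒eqLine {R = R N} s))

  sameLine-e : ∀ {a b c d} → SameLine R₁ a b c d → SameLine (R N) (e a) (e b) (e c) (e d)
  sameLine-e s = eqLine⇒sameLine {R = R N} (eqLine-e (sameLine⇒eqLine {R = R₁} s))

  meetCond-e : ∀ {a b c d q} → MeetCond R₁ a b c d q → MeetCond (R N) (e a) (e b) (e c) (e d) (e q)
  meetCond-e (ab , cd , ¬s , o₁ , o₂ , qa , qb , qc , qd) =
    e-≢ ab , e-≢ cd , (λ s → ¬s (e-sameLine s)) , onLine-e o₁ , onLine-e o₂ ,
    e-≢ qa , e-≢ qb , e-≢ qc , e-≢ qd

  e-meetCond : ∀ {a b c d q} → MeetCond (R N) (e a) (e b) (e c) (e d) (e q) → MeetCond R₁ a b c d q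
  e-meetCond (ab , cd , ¬s , o₁ , o₂ , qa , qb , qc , qd) =
    ≢-e ab , ≢-e cd , (λ s → ¬s (sameLine-e s)) , e-onLine o₁ , e-onLine o₂ ,
    ≢-e qa , ≢-e qb , ≢-e qc , ≢-e qd

module Induced {m n : ℕ} (N : ∧Matroid n) (ι : Fin m → Fin n) (ι-inj : Injective _≡_ _≡_ ι)
  (∧-closed : ∀ a b c d → ∃ λ e → ι e ≡ meet N (ι a) (ι b) (ι c) (ι d)) where

  R′ : Ternary m
  R′ a b c = R N (ι a) (ι b) (ι c)

  open AlongInjection R′ N ι ι-inj (λ _ _ _ → refl)

  meet′ : Fin m → Fin m → Fin m → Fin m → Fin m
  meet′ a b c d = proj₁ (∧-closed a b c d)

  meet′-spec : ∀ a b c d → MeetCond R′ a b c d (meet′ a b c d)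
    ⊎ ((¬ Σ (Fin m) (MeetCond R′ a b c d)) × meet′ a b c d ≡ a)
  meet′-spec a b c d with ∧-closed a b c d | meet-spec N (ι a) (ι b) (ι c) (ι d)
  ... | e , ιe≡ | inj₁ mc = inj₁ (e-meetCond (subst (MeetCond (R N) _ _ _ _) (sym ιe≡) mc))
  ... | e , ιe≡ | inj₂ (¬mc , ≡ιa) =
    inj₂ ((λ (q , mq) → ¬mc (ι q , meetCond-e mq)) , ι-inj (trans ιe≡ ≡ιa))

  induced : ∧Matroid m
  induced = record
    { R = R′ ; meet = meet′
    ; irrefl = λ a b c t → let x , y , z = irrefl N (ι a) (ι b) (ι c) t in ≢-e x , ≢-e y , ≢-e z
    ; sym₁₂ = λ a b c → sym₁₂ N (ι a) (ι b) (ι c)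
    ; sym₂₃ = λ a b c → sym₂₃ N (ι a) (ι b) (ι c)
    ; exch = λ a b c d t u c≢d → exch N (ι a) (ι b) (ι c) (ι d) t u (e-≢ c≢d)
    ; meet-spec = meet′-spec }

  ι-embedding : IsEmbedding induced N ι
  ι-embedding = record
    { injective = ι-inj ; pres-R = λ _ _ _ → refl ; pres-meet = λ a b c d → proj₂ (∧-closed a b c d) }

omits-substructureClosed : ∀ {p l} (P : ProjectivePlane p l) → SubstructureClosed (Omits P)
omits-substructureClosed P N ι N-omits ι-inj ∧-closed =
  induced , ι-embedding , omits-reflect P induced N ι (λ _ _ _ → refl) ι-inj N-omits
  where open Induced N ι ι-inj ∧-closed

-- Finite projective planes

module PlaneFacts {p l : ℕ} (P : ProjectivePlane p l) where

  On : Fin p → Fin l → Set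
  On x L = I P x L ≡ true

  on≢off : ∀ {x L} → On x L → I P x L ≡ false → ⊥
  on≢off on off = contradiction (trans (sym on) off) λ ()

  q : Fin 4 → Fin p
  q = proj₁ (quad P)

  q-≢ : ∀ {i j} → i ≢ j → q i ≢ q j
  q-≢ i≢j e = i≢j (proj₁ (proj₂ (quad P)) e)

  quad-noncollinear : ∀ i j k → i ≢ j → i ≢ k → j ≢ k →
    ¬ Σ (Fin l) λ L → On (q i) L × On (q j) L × On (q k) L
  quad-noncollinear = proj₂ (proj₂ (quad P))

  joinQ : ∀ i j → i ≢ j → Fin l
  joinQ i j i≢j = proj₁ (join P (q i) (q j) (q-≢ i≢j))

  joinQ-left : ∀ i j i≢j → On (q i) (joinQ i j i≢j)
  joinQ-left i j i≢j = proj₁ (proj₂ (join P (q i) (q j) (q-≢ i≢j)))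

  joinQ-right : ∀ i j i≢j → On (q j) (joinQ i j i≢j)
  joinQ-right i j i≢j = proj₂ (proj₂ (join P (q i) (q j) (q-≢ i≢j)))

  ThreePoints : Fin l → Set
  ThreePoints L = Σ (Fin p) λ x → Σ (Fin p) λ y → Σ (Fin p) λ z →
    x ≢ y × x ≢ z × y ≢ z × On x L × On y L × On z L

  quad-lines-meet-at-apex : ∀ {La Lb r} c d e → c ≢ d → c ≢ e → d ≢ e →
    On (q c) La → On (q c) Lb → On (q d) La → On (q e) Lb → On r La → On r Lb → r ≡ q c
  quad-lines-meet-at-apex {La} {Lb} {r} c d e c≢d c≢e d≢e cLa cLb dLa eLb rLa rLb with La ≟ Lb
  ... | yes refl = ⊥-elim (quad-noncollinear c d e c≢d c≢e d≢e (La , cLa , dLa , eLb))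
  ... | no La≢Lb = sym (cross-uniq P La Lb La≢Lb (q c) r cLa cLb rLa rLb)

  meet-joinQ : ∀ L i j (i≢j : i ≢ j) → I P (q i) L ≡ false →
    Σ (Fin p) λ r → On r L × On r (joinQ i j i≢j)
  meet-joinQ L i j i≢j off =
    cross P L (joinQ i j i≢j) (λ e → on≢off (subst (On (q i)) (sym e) (joinQ-left i j i≢j)) off)

  three-points-missing-quad : ∀ L i j k → (i≢j : i ≢ j) (i≢k : i ≢ k) (j≢k : j ≢ k) →
    I P (q i) L ≡ false → I P (q j) L ≡ false → I P (q k) L ≡ false → ThreePoints L
  three-points-missing-quad L i j k i≢j i≢k j≢k i∉L j∉L k∉L
    with meet-joinQ L i j i≢j i∉L | meet-joinQ L i k i≢k i∉L | meet-joinQ L j k j≢k j∉L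
  ... | r₁ , r₁L , r₁M | r₂ , r₂L , r₂M | r₃ , r₃L , r₃M =
    r₁ , r₂ , r₃ , r₁≢r₂ , r₁≢r₃ , r₂≢r₃ , r₁L , r₂L , r₃L
    where
    apex-on-L : ∀ {r x} → r ≡ q x → On r L → I P (q x) L ≡ false → ⊥
    apex-on-L refl rL x∉L = on≢off rL x∉L
    r₁≢r₂ : r₁ ≢ r₂
    r₁≢r₂ refl = apex-on-L (quad-lines-meet-at-apex i j k i≢j i≢k j≢k
      (joinQ-left i j i≢j) (joinQ-left i k i≢k) (joinQ-right i j i≢j) (joinQ-right i k i≢k) r₁M r₂M)
      r₁L i∉L
    r₁≢r₃ : r₁ ≢ r₃
    r₁≢r₃ refl = apex-on-L (quad-lines-meet-at-apex j i k (i≢j ∘′ sym) j≢k i≢k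
      (joinQ-right i j i≢j) (joinQ-left j k j≢k) (joinQ-left i j i≢j) (joinQ-right j k j≢k) r₁M r₃M)
      r₁L j∉L
    r₂≢r₃ : r₂ ≢ r₃
    r₂≢r₃ refl = apex-on-L (quad-lines-meet-at-apex k i j (i≢k ∘′ sym) (j≢k ∘′ sym) i≢j
      (joinQ-right i k i≢k) (joinQ-right j k j≢k) (joinQ-left i k i≢k) (joinQ-left j k j≢k) r₂M r₃M)
      r₂L k∉L

  three-points-through-quad : ∀ L i j k m → i ≢ j → i ≢ k → i ≢ m → j ≢ k → j ≢ m → k ≢ m →
    On (q i) L → On (q j) L → I P (q k) L ≡ false → ThreePoints L
  three-points-through-quad L i j k m i≢j i≢k i≢m j≢k j≢m k≢m iL jL k∉L
    with meet-joinQ L k m k≢m k∉L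
  ... | r , rL , rM = q i , q j , r , q-≢ i≢j , qi≢r , qj≢r , iL , jL , rL
    where
    kmLine : ∀ {x} → x ≢ k → x ≢ m → ¬ On (q x) (joinQ k m k≢m)
    kmLine {x} x≢k x≢m xM =
      quad-noncollinear x k m x≢k x≢m k≢m (joinQ k m k≢m , xM , joinQ-left k m k≢m , joinQ-right k m k≢m)
    qi≢r : q i ≢ r
    qi≢r refl = kmLine i≢k i≢m rM
    qj≢r : q j ≢ r
    qj≢r refl = kmLine j≢k j≢m rM

  i₀ i₁ i₂ i₃ : Fin 4
  i₀ = zero
  i₁ = suc zero
  i₂ = suc (suc zero)
  i₃ = suc (suc (suc zero))

  -- At most two quad points lie on L, so either three are off L, or two are on L and two are off.
  line-has-three-points : ∀ L → ThreePoints L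
  line-has-three-points L =
    go (I P (q i₀) L) refl (I P (q i₁) L) refl (I P (q i₂) L) refl (I P (q i₃) L) refl
    where
    go : ∀ b₀ → I P (q i₀) L ≡ b₀ → ∀ b₁ → I P (q i₁) L ≡ b₁ →
         ∀ b₂ → I P (q i₂) L ≡ b₂ → ∀ b₃ → I P (q i₃) L ≡ b₃ → ThreePoints L
    go true  e₀ true  e₁ true  e₂ _     _  =
      ⊥-elim (quad-noncollinear i₀ i₁ i₂ (λ ()) (λ ()) (λ ()) (L , e₀ , e₁ , e₂))
    go true  e₀ true  e₁ false e₂ true  e₃ =
      ⊥-elim (quad-noncollinear i₀ i₁ i₃ (λ ()) (λ ()) (λ ()) (L , e₀ , e₁ , e₃))
    go true  e₀ true  e₁ false e₂ false e₃ =
      three-points-through-quad L i₀ i₁ i₂ i₃ (λ ()) (λ ()) (λ ()) (λ ()) (λ ()) (λ ()) e₀ e₁ e₂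
    go true  e₀ false e₁ true  e₂ true  e₃ =
      ⊥-elim (quad-noncollinear i₀ i₂ i₃ (λ ()) (λ ()) (λ ()) (L , e₀ , e₂ , e₃))
    go true  e₀ false e₁ true  e₂ false e₃ =
      three-points-through-quad L i₀ i₂ i₁ i₃ (λ ()) (λ ()) (λ ()) (λ ()) (λ ()) (λ ()) e₀ e₂ e₁
    go true  e₀ false e₁ false e₂ true  e₃ =
      three-points-through-quad L i₀ i₃ i₁ i₂ (λ ()) (λ ()) (λ ()) (λ ()) (λ ()) (λ ()) e₀ e₃ e₁
    go true  e₀ false e₁ false e₂ false e₃ =
      three-points-missing-quad L i₁ i₂ i₃ (λ ()) (λ ()) (λ ()) e₁ e₂ e₃
    go false e₀ true  e₁ true  e₂ true  e₃ =
      ⊥-elim (quad-noncollinear i₁ i₂ i₃ (λ ()) (λ ()) (λ ()) (L , e₁ , e₂ , e₃))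
    go false e₀ true  e₁ true  e₂ false e₃ =
      three-points-through-quad L i₁ i₂ i₀ i₃ (λ ()) (λ ()) (λ ()) (λ ()) (λ ()) (λ ()) e₁ e₂ e₀
    go false e₀ true  e₁ false e₂ true  e₃ =
      three-points-through-quad L i₁ i₃ i₀ i₂ (λ ()) (λ ()) (λ ()) (λ ()) (λ ()) (λ ()) e₁ e₃ e₀
    go false e₀ true  e₁ false e₂ false e₃ =
      three-points-missing-quad L i₀ i₂ i₃ (λ ()) (λ ()) (λ ()) e₀ e₂ e₃
    go false e₀ false e₁ true  e₂ true  e₃ =
      three-points-through-quad L i₂ i₃ i₀ i₁ (λ ()) (λ ()) (λ ()) (λ ()) (λ ()) (λ ()) e₂ e₃ e₀
    go false e₀ false e₁ true  e₂ false e₃ =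
      three-points-missing-quad L i₀ i₁ i₃ (λ ()) (λ ()) (λ ()) e₀ e₁ e₃
    go false e₀ false e₁ false e₂ _     _  =
      three-points-missing-quad L i₀ i₁ i₂ (λ ()) (λ ()) (λ ()) e₀ e₁ e₂

  third-point : ∀ x y → x ≢ y → Σ (Fin p) λ z → R-MP P x y z
  third-point x y x≢y with join P x y x≢y
  ... | L , xL , yL with line-has-three-points L
  ... | u , v , w , u≢v , u≢w , v≢w , uL , vL , wL = pick (u ≟ x) (u ≟ y) (v ≟ x) (v ≟ y)
    where
    on : ∀ {z} → On z L → z ≢ x → z ≢ y → Σ (Fin p) λ z → R-MP P x y z
    on {z} zL z≢x z≢y = z , x≢y , (λ e → z≢x (sym e)) , (λ e → z≢y (sym e)) , L , xL , yL , zL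
    pick : Dec (u ≡ x) → Dec (u ≡ y) → Dec (v ≡ x) → Dec (v ≡ y) → Σ (Fin p) λ z → R-MP P x y z
    pick (no u≢x) (no u≢y) _ _ = on uL u≢x u≢y
    pick (yes refl) _ _ (no v≢y) = on vL (λ e → u≢v (sym e)) v≢y
    pick (yes refl) _ _ (yes refl) = on wL (λ e → u≢w (sym e)) (λ e → v≢w (sym e))
    pick (no _) (yes refl) (no v≢x) _ = on vL v≢x (λ e → u≢v (sym e))
    pick (no _) (yes refl) (yes refl) _ = on wL (λ e → v≢w (sym e)) (λ e → u≢w (sym e))

  point-off-line : ∀ x y → x ≢ y → Σ (Fin p) λ s → ¬ R-MP P x y s × s ≢ x × s ≢ y
  point-off-line x y x≢y with join P x y x≢y
  ... | L , xL , yL = pick (I P (q i₀) L) refl (I P (q i₁) L) refl (I P (q i₂) L) refl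
    where
    off : ∀ i → I P (q i) L ≡ false → Σ (Fin p) λ s → ¬ R-MP P x y s × s ≢ x × s ≢ y
    off i i∉L =
      q i ,
      (λ (_ , _ , _ , L′ , xL′ , yL′ , iL′) →
         on≢off (subst (On (q i)) (sym (join-uniq P x y x≢y L L′ xL yL xL′ yL′)) iL′) i∉L) ,
      (λ e → on≢off (subst (λ z → On z L) (sym e) xL) i∉L) ,
      (λ e → on≢off (subst (λ z → On z L) (sym e) yL) i∉L)
    pick : ∀ b₀ → I P (q i₀) L ≡ b₀ → ∀ b₁ → I P (q i₁) L ≡ b₁ → ∀ b₂ → I P (q i₂) L ≡ b₂ →
           Σ (Fin p) λ s → ¬ R-MP P x y s × s ≢ x × s ≢ y
    pick false e₀ _ _ _ _ = off i₀ e₀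
    pick true e₀ false e₁ _ _ = off i₁ e₁
    pick true e₀ true e₁ false e₂ = off i₂ e₂
    pick true e₀ true e₁ true e₂ =
      ⊥-elim (quad-noncollinear i₀ i₁ i₂ (λ ()) (λ ()) (λ ()) (L , e₀ , e₁ , e₂))

  other-point : ∀ x → Σ (Fin p) λ y → x ≢ y
  other-point x with x ≟ q i₀
  ... | yes refl = q i₁ , q-≢ (λ ())
  ... | no x≢q₀ = q i₀ , x≢q₀

-- The free amalgam

nothing≢just : ∀ {A : Set} {σ : A} → nothing ≢ just σ
nothing≢just ()

any-just : ∀ {A : Set} {P : A → Set} {m} → Any P m → ∃ λ σ → m ≡ just σ × P σ
any-just (just p) = _ , refl , p

any-at : ∀ {A : Set} {P : A → Set} {m σ} → m ≡ just σ → P σ → Any P m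
any-at refl p = just p

any-nothing : ∀ {A : Set} {P : A → Set} {m} → m ≡ nothing → ¬ Any P m
any-nothing refl ()

is-just? : ∀ {A : Set} (m : Maybe A) → Dec (Is-just m)
is-just? = Any.dec (λ _ → yes tt)

¬is-just⇒nothing : ∀ {A : Set} {m : Maybe A} → ¬ Is-just m → m ≡ nothing
¬is-just⇒nothing {m = just _} ¬j = ⊥-elim (¬j (just tt))
¬is-just⇒nothing {m = nothing} _ = refl

just-other : ∀ {A A′ : Set} {m : Maybe A} {m′ : Maybe A′} → Is-just m ⊎ Is-just m′ → ¬ Is-just m →
             ∃ λ σ → m′ ≡ just σ
just-other (inj₁ j) ¬j = ⊥-elim (¬j j)
just-other (inj₂ j) _ = let σ , e , _ = any-just j in σ , e

does-true⇒ : ∀ {A : Set} (a? : Dec A) → does a? ≡ true → A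
does-true⇒ (yes a) _ = a

≡does : ∀ {A : Set} (r : Bool) (a? : Dec A) → (r ≡ true → A) → (A → r ≡ true) → r ≡ does a?
≡does true  (yes _) _ _ = refl
≡does true  (no ¬a) r⇒a _ = ⊥-elim (¬a (r⇒a refl))
≡does false (yes a) _ a⇒r = a⇒r a
≡does false (no _) _ _ = refl

∃-⊎? : ∀ {A B : Set} {Q : A ⊎ B → Set} →
       Dec (Σ A λ x → Q (inj₁ x)) → Dec (Σ B λ y → Q (inj₂ y)) → Dec (Σ (A ⊎ B) Q)
∃-⊎? (yes (x , q)) _ = yes (inj₁ x , q)
∃-⊎? (no _) (yes (y , q)) = yes (inj₂ y , q)
∃-⊎? (no ¬l) (no ¬r) = no λ { (inj₁ x , q) → ¬l (x , q) ; (inj₂ y , q) → ¬r (y , q) }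

∃-pair? : ∀ {k} {Q : Fin k × Fin k → Set} → (∀ p → Dec (Q p)) → Dec (Σ (Fin k × Fin k) Q)
∃-pair? Q? = map′ (λ (x , y , q) → (x , y) , q) (λ ((x , y) , q) → x , y , q)
                  (any? λ x → any? λ y → Q? (x , y))

module Amalgam {a b c : ℕ} (A : ∧Matroid a) (B : ∧Matroid b) (C : ∧Matroid c)
  (f : Fin a → Fin b) (f-emb : IsEmbedding A B f)
  (g : Fin a → Fin c) (g-emb : IsEmbedding A C g) where

  -- The amalgam lives on Fin b ⊎ Fin c, and the trace of a point in B or C is the point it represents
  -- there.  A point inj₂ (g x) duplicates base x: it is kept as an isolated point traced in neither
  -- side, so that the carrier needs no counting.
  Point : Set
  Point = Fin b ⊎ Fin c

  base : Fin a → Point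
  base x = inj₁ (f x)

  f-inj : Injective _≡_ _≡_ f
  f-inj = IsEmbedding.injective f-emb

  g-inj : Injective _≡_ _≡_ g
  g-inj = IsEmbedding.injective g-emb

  traceB : Point → Maybe (Fin b)
  traceB (inj₁ β) = just β
  traceB (inj₂ _) = nothing

  traceC-left : ∀ β → Dec (∃ λ x → f x ≡ β) → Maybe (Fin c)
  traceC-left β (yes (x , _)) = just (g x)
  traceC-left β (no _) = nothing

  traceC-right : ∀ γ → Dec (∃ λ x → g x ≡ γ) → Maybe (Fin c)
  traceC-right γ (yes _) = nothing
  traceC-right γ (no _) = just γ

  traceC : Point → Maybe (Fin c)
  traceC (inj₁ β) = traceC-left β (any? λ x → f x ≟ β)
  traceC (inj₂ γ) = traceC-right γ (any? λ x → g x ≟ γ)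

  traceC-left-just : ∀ {β d σ} → traceC-left β d ≡ just σ → ∃ λ x → f x ≡ β × g x ≡ σ
  traceC-left-just {d = yes (x , fx≡β)} eq = x , fx≡β , just-injective eq

  traceC-right-just : ∀ {γ d σ} → traceC-right γ d ≡ just σ → γ ≡ σ × ¬ (∃ λ x → g x ≡ γ)
  traceC-right-just {d = no γ∉g} eq = just-injective eq , γ∉g

  embedC : Fin c → Point
  embedC γ with any? (λ x → g x ≟ γ)
  ... | yes (x , _) = base x
  ... | no _ = inj₂ γ

  traceC-base : ∀ x → traceC (base x) ≡ just (g x)
  traceC-base x with any? (λ y → f y ≟ f x)
  ... | yes (y , fy≡fx) = cong (λ z → just (g z)) (f-inj fy≡fx)
  ... | no ¬fx = ⊥-elim (¬fx (x , refl))

  traceC-embedC : ∀ γ → traceC (embedC γ) ≡ just γ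
  traceC-embedC γ with any? (λ x → g x ≟ γ)
  ... | yes (x , gx≡γ) = trans (traceC-base x) (cong just gx≡γ)
  ... | no γ∉g with any? (λ x → g x ≟ γ)
  ...   | yes γ∈g = ⊥-elim (γ∉g γ∈g)
  ...   | no _ = refl

  traceC-injective : ∀ {u v σ} → traceC u ≡ just σ → traceC v ≡ just σ → u ≡ v
  traceC-injective {inj₁ _} {inj₁ _} e₁ e₂ with traceC-left-just e₁ | traceC-left-just e₂
  ... | x , refl , gx | x′ , refl , gx′ = cong base (g-inj (trans gx (sym gx′)))
  traceC-injective {inj₁ _} {inj₂ _} e₁ e₂ with traceC-left-just e₁ | traceC-right-just e₂
  ... | x , refl , gx | γ≡ , γ∉g = ⊥-elim (γ∉g (x , trans gx (sym γ≡)))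
  traceC-injective {inj₂ _} {inj₁ _} e₁ e₂ with traceC-right-just e₁ | traceC-left-just e₂
  ... | γ≡ , γ∉g | x , refl , gx = ⊥-elim (γ∉g (x , trans gx (sym γ≡)))
  traceC-injective {inj₂ _} {inj₂ _} e₁ e₂ with traceC-right-just e₁ | traceC-right-just e₂
  ... | γ≡ , _ | γ′≡ , _ = cong inj₂ (trans γ≡ (sym γ′≡))

  traceB-injective : ∀ {u v σ} → traceB u ≡ just σ → traceB v ≡ just σ → u ≡ v
  traceB-injective {inj₁ _} {inj₁ _} e₁ e₂ =
    cong inj₁ (trans (just-injective e₁) (sym (just-injective e₂)))

  traced-twice⇒base : ∀ {u β γ} → traceB u ≡ just β → traceC u ≡ just γ → ∃ λ x → u ≡ base x
  traced-twice⇒base {inj₁ _} _ e with traceC-left-just e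
  ... | x , refl , _ = x , refl

  record Side : Set where
    field
      size            : ℕ
      M               : ∧Matroid size
      ι               : Fin a → Fin size
      ι-emb           : IsEmbedding A M ι
      trace           : Point → Maybe (Fin size)
      embed           : Fin size → Point
      trace-embed     : ∀ σ → trace (embed σ) ≡ just σ
      trace-injective : ∀ {u v σ} → trace u ≡ just σ → trace v ≡ just σ → u ≡ v
      trace-base      : ∀ x → trace (base x) ≡ just (ι x)

  open Side

  sideB : Side
  sideB = record
    { size = b ; M = B ; ι = f ; ι-emb = f-emb ; trace = traceB ; embed = inj₁
    ; trace-embed = λ _ → refl ; trace-injective = traceB-injective ; trace-base = λ _ → refl }

  sideC : Side
  sideC = record
    { size = c ; M = C ; ι = g ; ι-emb = g-emb ; trace = traceC ; embed = embedC
    ; trace-embed = traceC-embedC ; trace-injective = traceC-injective ; trace-base = traceC-base }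

  OnSideLine : (S : Side) → Fin (size S) → Fin (size S) → Point → Set
  OnSideLine S σ₁ σ₂ u = Any (OnLine (R (M S)) σ₁ σ₂) (trace S u)

  OnBaseLine : (S : Side) → Fin a → Fin a → Point → Set
  OnBaseLine S x₁ x₂ = OnSideLine S (ι S x₁) (ι S x₂)

  -- A line of the amalgam is coded by two points of one side, or by two points x₁ x₂ of A;
  -- the latter stands for the union of the lines through x₁ x₂ in both sides.
  LineCode : Side → Side → Set
  LineCode S T = (Fin (size S) × Fin (size S)) ⊎ (Fin (size T) × Fin (size T)) ⊎ (Fin a × Fin a)

  OnCode : (S T : Side) → LineCode S T → Point → Set
  OnCode S T (inj₁ (σ₁ , σ₂))        = OnSideLine S σ₁ σ₂
  OnCode S T (inj₂ (inj₁ (τ₁ , τ₂))) = OnSideLine T τ₁ τ₂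
  OnCode S T (inj₂ (inj₂ (x₁ , x₂))) u = OnBaseLine S x₁ x₂ u ⊎ OnBaseLine T x₁ x₂ u

  swapCode : ∀ {S T} → LineCode S T → LineCode T S
  swapCode (inj₁ σ)        = inj₂ (inj₁ σ)
  swapCode (inj₂ (inj₁ τ)) = inj₁ τ
  swapCode (inj₂ (inj₂ x)) = inj₂ (inj₂ x)

  onCode-swap : ∀ S T (ℓ : LineCode S T) u → OnCode S T ℓ u → OnCode T S (swapCode {S} {T} ℓ) u
  onCode-swap _ _ (inj₁ _)        _ o = o
  onCode-swap _ _ (inj₂ (inj₁ _)) _ o = o
  onCode-swap _ _ (inj₂ (inj₂ _)) _ o = swap o

  module SideFacts (S : Side) where
    open AlongInjection (R A) (M S) (ι S) (IsEmbedding.injective (ι-emb S)) (IsEmbedding.pres-R (ι-emb S)) public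

    -- Otherwise ι would send their ∧ to the meeting point.
    eqLine-meeting-off-image : ∀ {x₁ x₂ x₃ x₄ σ} →
      OnLine (R (M S)) (ι S x₁) (ι S x₂) σ → OnLine (R (M S)) (ι S x₃) (ι S x₄) σ →
      (∀ y → ι S y ≢ σ) → EqLine (R A) x₁ x₂ x₃ x₄
    eqLine-meeting-off-image {x₁} {x₂} {x₃} {x₄} {σ} o₁ o₂ σ∉ι
      with MatroidLines.sameLine? A x₁ x₂ x₃ x₄
    ... | yes s = sameLine⇒eqLine s
    ... | no ¬s = ⊥-elim (σ∉ι (meet A x₁ x₂ x₃ x₄)
                    (trans (IsEmbedding.pres-meet (ι-emb S) x₁ x₂ x₃ x₄) (meet-≡ (M S) meetσ)))
      where
      x₁≢x₂ : x₁ ≢ x₂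
      x₁≢x₂ refl = σ∉ι x₁ (sym (MatroidLines.onLine-degenerate (M S) o₁))
      x₃≢x₄ : x₃ ≢ x₄
      x₃≢x₄ refl = σ∉ι x₃ (sym (MatroidLines.onLine-degenerate (M S) o₂))
      meetσ : MeetCond (R (M S)) (ι S x₁) (ι S x₂) (ι S x₃) (ι S x₄) σ
      meetσ = e-≢ x₁≢x₂ , e-≢ x₃≢x₄ , (λ s → ¬s (e-sameLine s)) , o₁ , o₂ ,
              σ∉ι x₁ ∘′ sym , σ∉ι x₂ ∘′ sym , σ∉ι x₃ ∘′ sym , σ∉ι x₄ ∘′ sym

    trace-unique : ∀ {u σ τ} → trace S u ≡ just σ → trace S u ≡ just τ → σ ≡ τ
    trace-unique e₁ e₂ = just-injective (trans (sym e₁) e₂)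

    trace⇒embed : ∀ {u σ} → trace S u ≡ just σ → u ≡ embed S σ
    trace⇒embed e = trace-injective S e (trace-embed S _)

    trace-ι⇒base : ∀ {u x} → trace S u ≡ just (ι S x) → u ≡ base x
    trace-ι⇒base e = trace-injective S e (trace-base S _)

    trace-≢ : ∀ {u v σ τ} → trace S u ≡ just σ → trace S v ≡ just τ → u ≢ v → σ ≢ τ
    trace-≢ e₁ e₂ u≢v refl = u≢v (trace-injective S e₁ e₂)

    onSideLine-trace : ∀ {ρ₁ ρ₂ u σ} → OnSideLine S ρ₁ ρ₂ u → trace S u ≡ just σ →
                       OnLine (R (M S)) ρ₁ ρ₂ σ
    onSideLine-trace o e with any-just o
    ... | _ , e′ , oσ = subst (OnLine (R (M S)) _ _) (trace-unique e′ e) oσ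

    trace-off-image : ∀ {u σ} (T : Side) → trace S u ≡ just σ → trace T u ≡ nothing → ∀ y → ι S y ≢ σ
    trace-off-image T e e′ y ιy≡σ = nothing≢just (begin
      nothing              ≡⟨ sym e′ ⟩
      trace T _            ≡⟨ cong (trace T) (trace-ι⇒base (trans e (cong just (sym ιy≡σ)))) ⟩
      trace T (base y)     ≡⟨ trace-base T y ⟩
      just (ι T y)         ∎)
      where open ≡-Reasoning

  module TwoSides (S T : Side)
    (traced-twice⇒base′ : ∀ {u σ τ} → trace S u ≡ just σ → trace T u ≡ just τ → ∃ λ x → u ≡ base x) where

    module FS = SideFacts S
    module FT = SideFacts T
    module LS = MatroidLines (M S)
    module LT = MatroidLines (M T)

    Code : Set
    Code = LineCode S T

    On : Code → Point → Set
    On = OnCode S T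

    baseCode : Fin a → Fin a → Code
    baseCode x₁ x₂ = inj₂ (inj₂ (x₁ , x₂))

    _⊆ᶜ_ : Code → Code → Set
    ℓ ⊆ᶜ ℓ′ = ∀ u → On ℓ u → On ℓ′ u

    traced-twice : ∀ {u σ τ} → trace S u ≡ just σ → trace T u ≡ just τ →
                   ∃ λ y → u ≡ base y × σ ≡ ι S y × τ ≡ ι T y
    traced-twice e₁ e₂ with traced-twice⇒base′ e₁ e₂
    ... | y , refl = y , refl , FS.trace-unique e₁ (trace-base S y) , FT.trace-unique e₂ (trace-base T y)

    onBaseLine-trace : ∀ {x₁ x₂ u σ} → OnBaseLine S x₁ x₂ u ⊎ OnBaseLine T x₁ x₂ u →
                       trace S u ≡ just σ → OnLine (R (M S)) (ι S x₁) (ι S x₂) σ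
    onBaseLine-trace (inj₁ o) e = FS.onSideLine-trace o e
    onBaseLine-trace (inj₂ o) e with any-just o
    ... | τ , e′ , oτ with traced-twice e e′
    ... | y , refl , refl , refl = FS.onLine-e (FT.e-onLine oτ)

    onCode⇒triple : ∀ {u₁ u₂ u₃ σ₁ σ₂ σ₃} → u₁ ≢ u₂ → u₁ ≢ u₃ → u₂ ≢ u₃ →
      trace S u₁ ≡ just σ₁ → trace S u₂ ≡ just σ₂ → trace S u₃ ≡ just σ₃ →
      ∀ ℓ → On ℓ u₁ → On ℓ u₂ → On ℓ u₃ → R (M S) σ₁ σ₂ σ₃ ≡ true
    onCode⇒triple n₁₂ n₁₃ n₂₃ e₁ e₂ e₃ (inj₁ _) o₁ o₂ o₃ =
      LS.onLine⇒triple (FS.onSideLine-trace o₁ e₁) (FS.onSideLine-trace o₂ e₂) (FS.onSideLine-trace o₃ e₃)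
        (FS.trace-≢ e₁ e₂ n₁₂) (FS.trace-≢ e₁ e₃ n₁₃) (FS.trace-≢ e₂ e₃ n₂₃)
    onCode⇒triple n₁₂ n₁₃ n₂₃ e₁ e₂ e₃ (inj₂ (inj₁ _)) o₁ o₂ o₃
      with any-just o₁ | any-just o₂ | any-just o₃
    ... | _ , e₁′ , o₁′ | _ , e₂′ , o₂′ | _ , e₃′ , o₃′
      with traced-twice e₁ e₁′ | traced-twice e₂ e₂′ | traced-twice e₃ e₃′
    ... | y₁ , refl , refl , refl | y₂ , refl , refl , refl | y₃ , refl , refl , refl =
      FS.triple-e (FT.e-triple (LT.onLine⇒triple o₁′ o₂′ o₃′
        (FT.e-≢ (≢-base n₁₂)) (FT.e-≢ (≢-base n₁₃)) (FT.e-≢ (≢-base n₂₃))))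
      where
      ≢-base : ∀ {x y} → base x ≢ base y → x ≢ y
      ≢-base bx≢by x≡y = bx≢by (cong base x≡y)
    onCode⇒triple n₁₂ n₁₃ n₂₃ e₁ e₂ e₃ (inj₂ (inj₂ _)) o₁ o₂ o₃ =
      LS.onLine⇒triple (onBaseLine-trace o₁ e₁) (onBaseLine-trace o₂ e₂) (onBaseLine-trace o₃ e₃)
        (FS.trace-≢ e₁ e₂ n₁₂) (FS.trace-≢ e₁ e₃ n₁₃) (FS.trace-≢ e₂ e₃ n₂₃)

    merge-sideLine : ∀ σ₁ σ₂ ℓ u v → u ≢ v → OnSideLine S σ₁ σ₂ u → OnSideLine S σ₁ σ₂ v →
      On ℓ u → On ℓ v → Σ Code λ ℓ′ → inj₁ (σ₁ , σ₂) ⊆ᶜ ℓ′ × ℓ ⊆ᶜ ℓ′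
    merge-sideLine σ₁ σ₂ (inj₁ _) u v u≢v ou ov ou′ ov′ with any-just ou | any-just ov
    ... | _ , eu , ou″ | _ , ev , ov″ =
      inj₁ (σ₁ , σ₂) , (λ _ o → o) , (λ _ → Any.map (proj₂ E₁ _ ∘′ proj₁ E₂ _))
      where
      E₁ = LS.eqLine-through ou″ ov″ (FS.trace-≢ eu ev u≢v)
      E₂ = LS.eqLine-through (FS.onSideLine-trace ou′ eu) (FS.onSideLine-trace ov′ ev)
                             (FS.trace-≢ eu ev u≢v)
    merge-sideLine σ₁ σ₂ (inj₂ (inj₁ _)) u v u≢v ou ov ou′ ov′
      with any-just ou | any-just ov | any-just ou′ | any-just ov′
    ... | _ , eu , ou″ | _ , ev , ov″ | _ , eu′ , ou‴ | _ , ev′ , ov‴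
      with traced-twice eu eu′ | traced-twice ev ev′
    ... | yu , refl , refl , refl | yv , refl , refl , refl =
      baseCode yu yv , (λ _ → inj₁ ∘′ Any.map (proj₁ E₁ _)) , (λ _ → inj₂ ∘′ Any.map (proj₁ E₂ _))
      where
      E₁ = LS.eqLine-through ou″ ov″ (FS.trace-≢ eu ev u≢v)
      E₂ = LT.eqLine-through ou‴ ov‴ (FT.trace-≢ eu′ ev′ u≢v)
    merge-sideLine σ₁ σ₂ (inj₂ (inj₂ x)) u v u≢v ou ov ou′ ov′ with any-just ou | any-just ov
    ... | _ , eu , ou″ | _ , ev , ov″ =
      inj₂ (inj₂ x) , (λ _ → inj₁ ∘′ Any.map (proj₂ E₂ _ ∘′ proj₁ E₁ _)) , (λ _ o → o)
      where
      E₁ = LS.eqLine-through ou″ ov″ (FS.trace-≢ eu ev u≢v)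
      E₂ = LS.eqLine-through (onBaseLine-trace ou′ eu) (onBaseLine-trace ov′ ev) (FS.trace-≢ eu ev u≢v)

    baseLine-through-untraced : ∀ {u₁ u₂ w σ₁ σ₂} → σ₁ ≢ σ₂ →
      trace S u₁ ≡ just σ₁ → trace S u₂ ≡ just σ₂ → trace S w ≡ nothing →
      ∀ ℓ → On ℓ u₁ → On ℓ u₂ → On ℓ w →
      Σ (Fin a) λ x₁ → Σ (Fin a) λ x₂ → x₁ ≢ x₂ × OnLine (R (M S)) (ι S x₁) (ι S x₂) σ₁ ×
        OnLine (R (M S)) (ι S x₁) (ι S x₂) σ₂ × OnBaseLine T x₁ x₂ w
    baseLine-through-untraced _ _ _ ew (inj₁ _) _ _ ow = ⊥-elim (any-nothing ew ow)
    baseLine-through-untraced σ₁≢σ₂ e₁ e₂ ew (inj₂ (inj₁ _)) o₁ o₂ ow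
      with any-just o₁ | any-just o₂
    ... | _ , e₁′ , o₁′ | _ , e₂′ , o₂′ with traced-twice e₁ e₁′ | traced-twice e₂ e₂′
    ... | y₁ , refl , refl , refl | y₂ , refl , refl , refl =
      y₁ , y₂ , (λ e → σ₁≢σ₂ (cong (ι S) e)) , LS.onLine-left , LS.onLine-right ,
      Any.map (proj₁ (LT.eqLine-through o₁′ o₂′ (FT.e-≢ (λ e → σ₁≢σ₂ (cong (ι S) e)))) _) ow
    baseLine-through-untraced _ _ _ ew (inj₂ (inj₂ _)) _ _ (inj₁ ow) = ⊥-elim (any-nothing ew ow)
    baseLine-through-untraced σ₁≢σ₂ e₁ e₂ ew (inj₂ (inj₂ (x₁ , x₂))) o₁ o₂ (inj₂ ow) =
      x₁ , x₂ , x₁≢x₂ , onBaseLine-trace o₁ e₁ , onBaseLine-trace o₂ e₂ , ow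
      where
      x₁≢x₂ : x₁ ≢ x₂
      x₁≢x₂ refl = σ₁≢σ₂ (trans (LS.onLine-degenerate (onBaseLine-trace o₁ e₁))
                                (sym (LS.onLine-degenerate (onBaseLine-trace o₂ e₂))))

    eqLine-at-T-untraced : ∀ {x₁ x₂ x₃ x₄ u} → trace T u ≡ nothing →
      On (baseCode x₁ x₂) u → On (baseCode x₃ x₄) u → EqLine (R A) x₁ x₂ x₃ x₄
    eqLine-at-T-untraced eT (inj₂ o) _ = ⊥-elim (any-nothing eT o)
    eqLine-at-T-untraced eT (inj₁ o₁₂) o₃₄ with any-just o₁₂
    ... | _ , eS , _ =
      FS.eqLine-meeting-off-image (onBaseLine-trace (inj₁ o₁₂) eS) (onBaseLine-trace o₃₄ eS)
                                  (FS.trace-off-image T eS eT)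

    baseLine-through-untraced-pair : ∀ ℓ {v z} → trace T v ≡ nothing → trace S z ≡ nothing →
      On ℓ v → On ℓ z → Σ (Fin a) λ x₁ → Σ (Fin a) λ x₂ → OnBaseLine S x₁ x₂ v × OnBaseLine T x₁ x₂ z
    baseLine-through-untraced-pair (inj₁ _) _ ez _ oz = ⊥-elim (any-nothing ez oz)
    baseLine-through-untraced-pair (inj₂ (inj₁ _)) ev _ ov _ = ⊥-elim (any-nothing ev ov)
    baseLine-through-untraced-pair (inj₂ (inj₂ _)) ev _ (inj₂ ov) _ = ⊥-elim (any-nothing ev ov)
    baseLine-through-untraced-pair (inj₂ (inj₂ _)) _ ez (inj₁ _) (inj₁ oz) = ⊥-elim (any-nothing ez oz)
    baseLine-through-untraced-pair (inj₂ (inj₂ (x₁ , x₂))) _ _ (inj₁ ov) (inj₂ oz) = x₁ , x₂ , ov , oz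

    common-baseLine : ∀ {v z₁ z₂ σ} ℓ₁ ℓ₂ → trace S v ≡ just σ → trace T v ≡ nothing →
      trace S z₁ ≡ nothing → trace S z₂ ≡ nothing → On ℓ₁ v → On ℓ₁ z₁ → On ℓ₂ v → On ℓ₂ z₂ →
      Σ (Fin a) λ x₁ → Σ (Fin a) λ x₂ →
        OnBaseLine S x₁ x₂ v × OnBaseLine T x₁ x₂ z₁ × OnBaseLine T x₁ x₂ z₂
    common-baseLine ℓ₁ ℓ₂ eS eT e₁ e₂ ov₁ oz₁ ov₂ oz₂
      with baseLine-through-untraced-pair ℓ₁ eT e₁ ov₁ oz₁ | baseLine-through-untraced-pair ℓ₂ eT e₂ ov₂ oz₂
    ... | x₁ , x₂ , sv₁ , tz₁ | _ , _ , sv₂ , tz₂ =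
      x₁ , x₂ , sv₁ , tz₁ , Any.map (proj₂ (FT.eqLine-e E) _) tz₂
      where
      E = FS.eqLine-meeting-off-image (FS.onSideLine-trace sv₁ eS) (FS.onSideLine-trace sv₂ eS)
                                      (FS.trace-off-image T eS eT)

  traced-twice⇒base-CB : ∀ {u γ β} → traceC u ≡ just γ → traceB u ≡ just β → ∃ λ x → u ≡ base x
  traced-twice⇒base-CB e₁ e₂ = traced-twice⇒base e₂ e₁

  module BC = TwoSides sideB sideC traced-twice⇒base
  module CB = TwoSides sideC sideB traced-twice⇒base-CB
  module FB = SideFacts sideB
  module FC = SideFacts sideC

  open BC public using (On; baseCode) renaming (Code to Line; _⊆ᶜ_ to _⊆ᴸ_)

  eqLine-baseCodes : ∀ {x₁ x₂ x₃ x₄ u v} → u ≢ v → On (baseCode x₁ x₂) u → On (baseCode x₁ x₂) v →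
    On (baseCode x₃ x₄) u → On (baseCode x₃ x₄) v → EqLine (R A) x₁ x₂ x₃ x₄
  eqLine-baseCodes {x₁} {x₂} {x₃} {x₄} {u} {v} u≢v ou ov ou′ ov′ =
    by-traceB (traceB u) refl (traceB v) refl
    where
    by-traceB : ∀ mu → traceB u ≡ mu → ∀ mv → traceB v ≡ mv → EqLine (R A) x₁ x₂ x₃ x₄
    by-traceB nothing eu _ _ = CB.eqLine-at-T-untraced eu (swap ou) (swap ou′)
    by-traceB (just _) _ nothing ev = CB.eqLine-at-T-untraced ev (swap ov) (swap ov′)
    by-traceB (just _) eu (just _) ev = FB.e-eqLine (BC.LS.eqLine-trans
      (BC.LS.eqLine-through (BC.onBaseLine-trace ou eu) (BC.onBaseLine-trace ov ev) u′≢v′)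
      (BC.LS.eqLine-sym (BC.LS.eqLine-through (BC.onBaseLine-trace ou′ eu) (BC.onBaseLine-trace ov′ ev) u′≢v′)))
      where u′≢v′ = FB.trace-≢ eu ev u≢v

  baseCode-⊆ : ∀ {x₁ x₂ x₃ x₄} → EqLine (R A) x₁ x₂ x₃ x₄ → baseCode x₃ x₄ ⊆ᴸ baseCode x₁ x₂
  baseCode-⊆ E _ (inj₁ o) = inj₁ (Any.map (proj₂ (FB.eqLine-e E) _) o)
  baseCode-⊆ E _ (inj₂ o) = inj₂ (Any.map (proj₂ (FC.eqLine-e E) _) o)

  unswap-⊆ : ∀ ℓ₁ ℓ₂ → (Σ CB.Code λ ℓ → swapCode ℓ₁ CB.⊆ᶜ ℓ × swapCode ℓ₂ CB.⊆ᶜ ℓ) →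
             Σ Line λ ℓ → ℓ₁ ⊆ᴸ ℓ × ℓ₂ ⊆ᴸ ℓ
  unswap-⊆ ℓ₁ ℓ₂ (ℓ , p , q) =
    swapCode ℓ , (λ u o → onCode-swap sideC sideB ℓ u (p u (onCode-swap sideB sideC ℓ₁ u o))) ,
                 (λ u o → onCode-swap sideC sideB ℓ u (q u (onCode-swap sideB sideC ℓ₂ u o)))

  merge-lines : ∀ ℓ₁ ℓ₂ {u v} → u ≢ v → On ℓ₁ u → On ℓ₁ v → On ℓ₂ u → On ℓ₂ v →
                Σ Line λ ℓ → ℓ₁ ⊆ᴸ ℓ × ℓ₂ ⊆ᴸ ℓ
  merge-lines (inj₁ (σ₁ , σ₂)) ℓ₂ = BC.merge-sideLine σ₁ σ₂ ℓ₂ _ _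
  merge-lines (inj₂ (inj₁ (τ₁ , τ₂))) ℓ₂ u≢v ou ov ou′ ov′ =
    unswap-⊆ (inj₂ (inj₁ (τ₁ , τ₂))) ℓ₂
      (CB.merge-sideLine τ₁ τ₂ (swapCode ℓ₂) _ _ u≢v ou ov
        (onCode-swap _ _ ℓ₂ _ ou′) (onCode-swap _ _ ℓ₂ _ ov′))
  merge-lines (inj₂ (inj₂ x)) (inj₁ (σ₁ , σ₂)) u≢v ou ov ou′ ov′ =
    let ℓ , p , q = BC.merge-sideLine σ₁ σ₂ (inj₂ (inj₂ x)) _ _ u≢v ou′ ov′ ou ov in ℓ , q , p
  merge-lines (inj₂ (inj₂ x)) (inj₂ (inj₁ (τ₁ , τ₂))) u≢v ou ov ou′ ov′ =
    let ℓ , p , q = unswap-⊆ (inj₂ (inj₁ (τ₁ , τ₂))) (inj₂ (inj₂ x))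
                      (CB.merge-sideLine τ₁ τ₂ (inj₂ (inj₂ x)) _ _ u≢v ou′ ov′ (swap ou) (swap ov))
    in ℓ , q , p
  merge-lines (inj₂ (inj₂ x)) (inj₂ (inj₂ _)) u≢v ou ov ou′ ov′ =
    inj₂ (inj₂ x) , (λ _ o → o) , baseCode-⊆ (eqLine-baseCodes u≢v ou ov ou′ ov′)

  Collinear : Point → Point → Point → Set
  Collinear u v w = u ≢ v × u ≢ w × v ≢ w × Σ Line λ ℓ → On ℓ u × On ℓ v × On ℓ w

  collinear-swap₁₂ : ∀ {u v w} → Collinear u v w → Collinear v u w
  collinear-swap₁₂ (u≢v , u≢w , v≢w , ℓ , ou , ov , ow) = u≢v ∘′ sym , v≢w , u≢w , ℓ , ov , ou , ow

  collinear-swap₂₃ : ∀ {u v w} → Collinear u v w → Collinear u w v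
  collinear-swap₂₃ (u≢v , u≢w , v≢w , ℓ , ou , ov , ow) = u≢w , u≢v , v≢w ∘′ sym , ℓ , ou , ow , ov

  collinear-exch : ∀ {u v w z} → Collinear u v w → Collinear u v z → w ≢ z →
                   Collinear u w z × Collinear v w z
  collinear-exch (u≢v , u≢w , v≢w , ℓ₁ , ou , ov , ow) (_ , u≢z , v≢z , ℓ₂ , ou′ , ov′ , oz) w≢z
    with merge-lines ℓ₁ ℓ₂ u≢v ou ov ou′ ov′
  ... | ℓ , ℓ₁⊆ℓ , ℓ₂⊆ℓ =
    (u≢w , u≢z , w≢z , ℓ , ℓ₁⊆ℓ _ ou , ℓ₁⊆ℓ _ ow , ℓ₂⊆ℓ _ oz) ,
    (v≢w , v≢z , w≢z , ℓ , ℓ₁⊆ℓ _ ov , ℓ₁⊆ℓ _ ow , ℓ₂⊆ℓ _ oz)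

  collinear-rotate : ∀ {u v w} → Collinear u v w → Collinear v w u
  collinear-rotate c = collinear-swap₂₃ (collinear-swap₁₂ c)

  ¬collinear-through : ∀ {u v w z} → ¬ Collinear u v w → Collinear u w z → v ≢ w → ¬ Collinear u v z
  ¬collinear-through ¬uvw uwz v≢w uvz =
    ¬uvw (proj₁ (collinear-exch (collinear-swap₂₃ uvz) (collinear-swap₂₃ uwz) v≢w))

  ¬collinear⇒≢ : ∀ {u v w z} → ¬ Collinear u v w → Collinear v w z → z ≢ u
  ¬collinear⇒≢ ¬uvw vwz refl = ¬uvw (collinear-rotate (collinear-rotate vwz))

  onCode? : ∀ ℓ u → Dec (On ℓ u)
  onCode? (inj₁ (σ₁ , σ₂))        u = Any.dec (MatroidLines.onLine? B σ₁ σ₂) (traceB u)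
  onCode? (inj₂ (inj₁ (τ₁ , τ₂))) u = Any.dec (MatroidLines.onLine? C τ₁ τ₂) (traceC u)
  onCode? (inj₂ (inj₂ (x₁ , x₂))) u =
    Any.dec (MatroidLines.onLine? B (f x₁) (f x₂)) (traceB u) ⊎-dec
    Any.dec (MatroidLines.onLine? C (g x₁) (g x₂)) (traceC u)

  collinear? : ∀ u v w → Dec (Collinear u v w)
  collinear? u v w = ¬? (u ≟ᴾ v) ×-dec ¬? (u ≟ᴾ w) ×-dec ¬? (v ≟ᴾ w) ×-dec
                     ∃-⊎? (∃-pair? λ p → on? (inj₁ p))
                          (∃-⊎? (∃-pair? λ p → on? (inj₂ (inj₁ p))) (∃-pair? λ p → on? (inj₂ (inj₂ p))))
    where
    _≟ᴾ_ : DecidableEquality Point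
    _≟ᴾ_ = ≡-dec _≟_ _≟_
    on? : ∀ ℓ → Dec (On ℓ u × On ℓ v × On ℓ w)
    on? ℓ = onCode? ℓ u ×-dec onCode? ℓ v ×-dec onCode? ℓ w

  toPoint : Fin (b + c) → Point
  toPoint = splitAt b

  toPoint-injective : Injective _≡_ _≡_ toPoint
  toPoint-injective {x} {y} e =
    trans (sym (join-splitAt b c x)) (trans (cong (joinFin b c) e) (join-splitAt b c y))

  Collinearᴰ : Fin (b + c) → Fin (b + c) → Fin (b + c) → Set
  Collinearᴰ x y z = Collinear (toPoint x) (toPoint y) (toPoint z)

  collinearᴰ? : ∀ x y z → Dec (Collinearᴰ x y z)
  collinearᴰ? x y z = collinear? (toPoint x) (toPoint y) (toPoint z)

  R-D : Ternary (b + c)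
  R-D x y z = does (collinearᴰ? x y z)

  R-D⇒collinear : ∀ {x y z} → R-D x y z ≡ true → Collinearᴰ x y z
  R-D⇒collinear {x} {y} {z} = does-true⇒ (collinearᴰ? x y z)

  collinear⇒R-D : ∀ {x y z} → Collinearᴰ x y z → R-D x y z ≡ true
  collinear⇒R-D {x} {y} {z} = dec-true (collinearᴰ? x y z)

  R-D-irrefl : ∀ x y z → R-D x y z ≡ true → x ≢ y × x ≢ z × y ≢ z
  R-D-irrefl x y z t with R-D⇒collinear {x} {y} {z} t
  ... | x≢y , x≢z , y≢z , _ = x≢y ∘′ cong toPoint , x≢z ∘′ cong toPoint , y≢z ∘′ cong toPoint

  R-D-sym₁₂ : ∀ x y z → R-D x y z ≡ R-D y x z
  R-D-sym₁₂ x y z = does-⇔ (mk⇔ collinear-swap₁₂ collinear-swap₁₂) (collinearᴰ? x y z) (collinearᴰ? y x z)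

  R-D-sym₂₃ : ∀ x y z → R-D x y z ≡ R-D x z y
  R-D-sym₂₃ x y z = does-⇔ (mk⇔ collinear-swap₂₃ collinear-swap₂₃) (collinearᴰ? x y z) (collinearᴰ? x z y)

  R-D-exch : ∀ x y z w → R-D x y z ≡ true → R-D x y w ≡ true → z ≢ w →
             R-D x z w ≡ true × R-D y z w ≡ true
  R-D-exch x y z w t₁ t₂ z≢w
    with collinear-exch (R-D⇒collinear {x} {y} {z} t₁) (R-D⇒collinear {x} {y} {w} t₂) (z≢w ∘′ toPoint-injective)
  ... | c₁ , c₂ = collinear⇒R-D {x} {z} {w} c₁ , collinear⇒R-D {y} {z} {w} c₂

  module LD = Lines R-D R-D-irrefl R-D-sym₁₂ R-D-sym₂₃ R-D-exch

  D : ∧Matroid (b + c)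
  D = LD.matroid

  module SideEmbedding (S T : Side)
    (traced-twice⇒base′ : ∀ {u σ τ} → trace S u ≡ just σ → trace T u ≡ just τ → ∃ λ x → u ≡ base x)
    (toCode : Line → LineCode S T) (toCode-on : ∀ ℓ u → On ℓ u → OnCode S T (toCode ℓ) u)
    (sideCode : Fin (size S) → Fin (size S) → Line)
    (sideCode-on : ∀ σ₁ σ₂ u → OnSideLine S σ₁ σ₂ u → On (sideCode σ₁ σ₂) u) where

    open TwoSides S T traced-twice⇒base′
      using (module FS; module FT; module LS; onCode⇒triple; baseLine-through-untraced)

    into : Fin (size S) → Fin (b + c)
    into σ = joinFin b c (embed S σ)

    trace-into : ∀ σ → trace S (toPoint (into σ)) ≡ just σ
    trace-into σ = trans (cong (trace S) (splitAt-join b c (embed S σ))) (trace-embed S σ)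

    into-injective : Injective _≡_ _≡_ into
    into-injective {σ} {τ} e =
      just-injective (trans (sym (trace-into σ)) (trans (cong (trace S ∘′ toPoint) e) (trace-into τ)))

    into-R : ∀ σ₁ σ₂ σ₃ → R (M S) σ₁ σ₂ σ₃ ≡ R-D (into σ₁) (into σ₂) (into σ₃)
    into-R σ₁ σ₂ σ₃ =
      ≡does (R (M S) σ₁ σ₂ σ₃) (collinearᴰ? (into σ₁) (into σ₂) (into σ₃)) triple⇒collinear collinear⇒triple
      where
      ≢-toPoint : ∀ {σ τ} → σ ≢ τ → toPoint (into σ) ≢ toPoint (into τ)
      ≢-toPoint σ≢τ e = σ≢τ (into-injective (toPoint-injective e))
      on-sideCode : ∀ {σ} → OnLine (R (M S)) σ₁ σ₂ σ → On (sideCode σ₁ σ₂) (toPoint (into σ))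
      on-sideCode o = sideCode-on σ₁ σ₂ _ (any-at (trace-into _) o)
      triple⇒collinear : R (M S) σ₁ σ₂ σ₃ ≡ true → Collinearᴰ (into σ₁) (into σ₂) (into σ₃)
      triple⇒collinear t with irrefl (M S) σ₁ σ₂ σ₃ t
      ... | n₁₂ , n₁₃ , n₂₃ = ≢-toPoint n₁₂ , ≢-toPoint n₁₃ , ≢-toPoint n₂₃ , sideCode σ₁ σ₂ ,
            on-sideCode LS.onLine-left , on-sideCode LS.onLine-right , on-sideCode (inj₂ (inj₂ t))
      collinear⇒triple : Collinearᴰ (into σ₁) (into σ₂) (into σ₃) → R (M S) σ₁ σ₂ σ₃ ≡ true
      collinear⇒triple (n₁₂ , n₁₃ , n₂₃ , ℓ , o₁ , o₂ , o₃) =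
        onCode⇒triple n₁₂ n₁₃ n₂₃ (trace-into σ₁) (trace-into σ₂) (trace-into σ₃) (toCode ℓ)
          (toCode-on ℓ _ o₁) (toCode-on ℓ _ o₂) (toCode-on ℓ _ o₃)

    open AlongInjection (R (M S)) D into into-injective into-R

    untraced-on-image-line : ∀ {σ₁ σ₂ q} → σ₁ ≢ σ₂ → trace S (toPoint q) ≡ nothing →
      OnLine R-D (into σ₁) (into σ₂) q → q ≢ into σ₁ → q ≢ into σ₂ →
      Σ (Fin a) λ x₁ → Σ (Fin a) λ x₂ →
        EqLine (R (M S)) (ι S x₁) (ι S x₂) σ₁ σ₂ × OnBaseLine T x₁ x₂ (toPoint q)
    untraced-on-image-line _ _ (inj₁ e) q≢σ₁ _ = ⊥-elim (q≢σ₁ e)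
    untraced-on-image-line _ _ (inj₂ (inj₁ e)) _ q≢σ₂ = ⊥-elim (q≢σ₂ e)
    untraced-on-image-line {σ₁} {σ₂} {q} σ₁≢σ₂ eq (inj₂ (inj₂ t)) _ _
      with R-D⇒collinear {into σ₁} {into σ₂} {q} t
    ... | _ , _ , _ , ℓ , o₁ , o₂ , oq
      with baseLine-through-untraced σ₁≢σ₂ (trace-into σ₁) (trace-into σ₂) eq (toCode ℓ)
             (toCode-on ℓ _ o₁) (toCode-on ℓ _ o₂) (toCode-on ℓ _ oq)
    ... | x₁ , x₂ , _ , a₁ , a₂ , oT = x₁ , x₂ , LS.eqLine-through a₁ a₂ σ₁≢σ₂ , oT

    -- In T the common point lies, outside the image of A, on both A-lines, which therefore coincide.
    untraced-meet⇒eqLine : ∀ {σ₁ σ₂ σ₃ σ₄ q} → σ₁ ≢ σ₂ → σ₃ ≢ σ₄ → trace S (toPoint q) ≡ nothing →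
      OnLine R-D (into σ₁) (into σ₂) q → OnLine R-D (into σ₃) (into σ₄) q →
      q ≢ into σ₁ → q ≢ into σ₂ → q ≢ into σ₃ → q ≢ into σ₄ → EqLine (R (M S)) σ₁ σ₂ σ₃ σ₄
    untraced-meet⇒eqLine σ₁≢σ₂ σ₃≢σ₄ eq o₁₂ o₃₄ q₁ q₂ q₃ q₄
      with untraced-on-image-line σ₁≢σ₂ eq o₁₂ q₁ q₂ | untraced-on-image-line σ₃≢σ₄ eq o₃₄ q₃ q₄
    ... | x₁ , x₂ , E₁₂ , oT₁₂ | x₃ , x₄ , E₃₄ , oT₃₄ with any-just oT₁₂
    ... | τ , eτ , oτ =
      LS.eqLine-trans (LS.eqLine-sym E₁₂) (LS.eqLine-trans (FS.eqLine-e EA) E₃₄)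
      where
      EA = FT.eqLine-meeting-off-image oτ (FT.onSideLine-trace oT₃₄ eτ) (FT.trace-off-image S eτ eq)

    no-meet-in-D : ∀ {σ₁ σ₂ σ₃ σ₄} → ¬ Σ (Fin (size S)) (MeetCond (R (M S)) σ₁ σ₂ σ₃ σ₄) →
                   ∀ q → ¬ MeetCond R-D (into σ₁) (into σ₂) (into σ₃) (into σ₄) q
    no-meet-in-D {σ₁} {σ₂} {σ₃} {σ₄} ¬m q mc@(n₁₂ , n₃₄ , ¬s , o₁₂ , o₃₄ , q₁ , q₂ , q₃ , q₄) =
      by-trace (trace S (toPoint q)) refl
      where
      by-trace : ∀ m → trace S (toPoint q) ≡ m → ⊥
      by-trace (just τ) e with toPoint-injective (trans (FS.trace⇒embed e) (sym (splitAt-join b c (embed S τ))))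
      ... | refl = ¬m (τ , e-meetCond mc)
      by-trace nothing e = ¬s (sameLine-e (eqLine⇒sameLine {R = R (M S)}
        (untraced-meet⇒eqLine (≢-e n₁₂) (≢-e n₃₄) e o₁₂ o₃₄ q₁ q₂ q₃ q₄)))

    into-meet : ∀ σ₁ σ₂ σ₃ σ₄ →
                into (meet (M S) σ₁ σ₂ σ₃ σ₄) ≡ meet D (into σ₁) (into σ₂) (into σ₃) (into σ₄)
    into-meet σ₁ σ₂ σ₃ σ₄ = by-spec (meet-spec (M S) σ₁ σ₂ σ₃ σ₄)
      where
      by-spec : MeetCond (R (M S)) σ₁ σ₂ σ₃ σ₄ (meet (M S) σ₁ σ₂ σ₃ σ₄)
                ⊎ ((¬ Σ (Fin (size S)) (MeetCond (R (M S)) σ₁ σ₂ σ₃ σ₄)) × meet (M S) σ₁ σ₂ σ₃ σ₄ ≡ σ₁) →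
                into (meet (M S) σ₁ σ₂ σ₃ σ₄) ≡ meet D (into σ₁) (into σ₂) (into σ₃) (into σ₄)
      by-spec (inj₁ mc) = sym (meet-≡ D (meetCond-e mc))
      by-spec (inj₂ (¬mc , ≡σ₁)) =
        trans (cong into ≡σ₁) (sym (meet-≡-first D λ (q , mc) → no-meet-in-D ¬mc q mc))

    into-embedding : IsEmbedding (M S) D into
    into-embedding = record { injective = into-injective ; pres-R = into-R ; pres-meet = into-meet }

  module EB = SideEmbedding sideB sideC traced-twice⇒base (λ ℓ → ℓ) (λ _ _ o → o)
                            (λ σ₁ σ₂ → inj₁ (σ₁ , σ₂)) (λ _ _ _ o → o)
  module EC = SideEmbedding sideC sideB traced-twice⇒base-CB swapCode (onCode-swap sideB sideC)
                            (λ τ₁ τ₂ → inj₂ (inj₁ (τ₁ , τ₂))) (λ _ _ _ o → o)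

  into-commutes : ∀ x → EB.into (f x) ≡ EC.into (g x)
  into-commutes x = cong (joinFin b c) (sym (FC.trace-ι⇒base {embedC (g x)} {x} (traceC-embedC (g x))))

  collinear-through-B-only : ∀ {v z₁ z₂ w₁ w₂ β} → traceB v ≡ just β → traceC v ≡ nothing →
    traceB z₁ ≡ nothing → traceB z₂ ≡ nothing → z₁ ≢ z₂ →
    Collinear v z₁ w₁ → Collinear v z₂ w₂ → Collinear v z₁ z₂
  collinear-through-B-only eB eC e₁ e₂ z₁≢z₂ (v≢z₁ , _ , _ , ℓ₁ , ov₁ , oz₁ , _) (v≢z₂ , _ , _ , ℓ₂ , ov₂ , oz₂ , _)
    with BC.common-baseLine ℓ₁ ℓ₂ eB eC e₁ e₂ ov₁ oz₁ ov₂ oz₂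
  ... | x₁ , x₂ , ov , oz₁′ , oz₂′ = v≢z₁ , v≢z₂ , z₁≢z₂ , baseCode x₁ x₂ , inj₁ ov , inj₂ oz₁′ , inj₂ oz₂′

  collinear-through-C-only : ∀ {v z₁ z₂ w₁ w₂ γ} → traceC v ≡ just γ → traceB v ≡ nothing →
    traceC z₁ ≡ nothing → traceC z₂ ≡ nothing → z₁ ≢ z₂ →
    Collinear v z₁ w₁ → Collinear v z₂ w₂ → Collinear v z₁ z₂
  collinear-through-C-only eC eB e₁ e₂ z₁≢z₂ (v≢z₁ , _ , _ , ℓ₁ , ov₁ , oz₁ , _) (v≢z₂ , _ , _ , ℓ₂ , ov₂ , oz₂ , _)
    with CB.common-baseLine (swapCode ℓ₁) (swapCode ℓ₂) eC eB e₁ e₂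
           (onCode-swap _ _ ℓ₁ _ ov₁) (onCode-swap _ _ ℓ₁ _ oz₁)
           (onCode-swap _ _ ℓ₂ _ ov₂) (onCode-swap _ _ ℓ₂ _ oz₂)
  ... | x₁ , x₂ , ov , oz₁′ , oz₂′ = v≢z₁ , v≢z₂ , z₁≢z₂ , baseCode x₁ x₂ , inj₂ ov , inj₁ oz₁′ , inj₁ oz₂′

  base-collinear-through-B-only : ∀ {v β w₁ w₂ w₃ w₄ y₁ y₂ y₃ y₄} → traceB v ≡ just β → traceC v ≡ nothing →
    w₁ ≡ base y₁ → w₂ ≡ base y₂ → w₃ ≡ base y₃ → w₄ ≡ base y₄ →
    Collinear v w₁ w₂ → Collinear v w₃ w₄ → w₁ ≢ w₃ → Collinear v w₁ w₃
  base-collinear-through-B-only {β = β} {y₁ = y₁} {y₂} {y₃} {y₄} eB eC refl refl refl refl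
    (v≢w₁ , v≢w₂ , w₁≢w₂ , ℓ₁ , ov , ow₁ , ow₂) (v≢w₃ , v≢w₄ , w₃≢w₄ , ℓ₂ , ov′ , ow₃ , ow₄) w₁≢w₃ =
    v≢w₁ , v≢w₃ , w₁≢w₃ , baseCode y₁ y₂ ,
    inj₁ (any-at eB on₁₂) , inj₁ (just BC.LS.onLine-left) , inj₁ (just y₃-on)
    where
    on₁₂ : OnLine (R B) (f y₁) (f y₂) β
    on₁₂ = inj₂ (inj₂ (BC.LS.triple-rotate (BC.onCode⇒triple v≢w₁ v≢w₂ w₁≢w₂ eB refl refl ℓ₁ ov ow₁ ow₂)))
    on₃₄ : OnLine (R B) (f y₃) (f y₄) β
    on₃₄ = inj₂ (inj₂ (BC.LS.triple-rotate (BC.onCode⇒triple v≢w₃ v≢w₄ w₃≢w₄ eB refl refl ℓ₂ ov′ ow₃ ow₄)))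
    y₃-on : OnLine (R B) (f y₁) (f y₂) (f y₃)
    y₃-on = proj₂ (FB.eqLine-e (FB.eqLine-meeting-off-image on₁₂ on₃₄ (FB.trace-off-image sideC eB eC)))
                  (f y₃) BC.LS.onLine-left

  on-line⇒traced : ∀ ℓ u → On ℓ u → Is-just (traceB u) ⊎ Is-just (traceC u)
  on-line⇒traced (inj₁ _)        _ o        = inj₁ (Any.map (λ _ → tt) o)
  on-line⇒traced (inj₂ (inj₁ _)) _ o        = inj₂ (Any.map (λ _ → tt) o)
  on-line⇒traced (inj₂ (inj₂ _)) _ (inj₁ o) = inj₁ (Any.map (λ _ → tt) o)
  on-line⇒traced (inj₂ (inj₂ _)) _ (inj₂ o) = inj₂ (Any.map (λ _ → tt) o)

  module CopyInD {p l} (P : ProjectivePlane p l) (F : Fin p → Fin (b + c)) (F-inj : Injective _≡_ _≡_ F)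
                 (F-R : ∀ x y z → R-MP P x y z ⇔ (R-D (F x) (F y) (F z) ≡ true)) where

    open PlaneFacts P using (third-point; point-off-line; other-point)

    point : Fin p → Point
    point x = toPoint (F x)

    point-≢ : ∀ {x y} → x ≢ y → point x ≢ point y
    point-≢ x≢y e = x≢y (F-inj (toPoint-injective e))

    Col : Fin p → Fin p → Fin p → Set
    Col x y z = Collinear (point x) (point y) (point z)

    col⇒R-MP : ∀ {x y z} → Col x y z → R-MP P x y z
    col⇒R-MP {x} {y} {z} c = Equivalence.from (F-R x y z) (collinear⇒R-D {F x} {F y} {F z} c)

    third-col : ∀ x y → x ≢ y → Σ (Fin p) λ z → Col x y z
    third-col x y x≢y =
      let z , r = third-point x y x≢y in z , R-D⇒collinear {F x} {F y} {F z} (Equivalence.to (F-R x y z) r)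

    point-traced : ∀ x → Is-just (traceB (point x)) ⊎ Is-just (traceC (point x))
    point-traced x with other-point x
    ... | y , x≢y with third-col x y x≢y
    ... | _ , _ , _ , _ , ℓ , o , _ = on-line⇒traced ℓ (point x) o

    all-traced⇒copy : (S : Side) (e : Fin (size S) → Fin (b + c)) → PreservesR (M S) D e →
      (∀ σ → e σ ≡ joinFin b c (embed S σ)) → (∀ x → Is-just (trace S (point x))) → Copy P (M S)
    all-traced⇒copy S e e-R e≡ traced-S =
      copy-factor P (M S) D e e-R (F , F-inj , F-R) (λ x → proj₁ (any-just (traced-S x))) F≡eG
      where
      F≡eG : ∀ x → F x ≡ e (proj₁ (any-just (traced-S x)))
      F≡eG x = trans (sym (join-splitAt b c (F x)))
                     (trans (cong (joinFin b c) (SideFacts.trace⇒embed S (proj₁ (proj₂ (any-just (traced-S x))))))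
                            (sym (e≡ _)))

    module StraddlingCopy {x₀ y₀ γ₀ β₀}
      (x₀-C : traceC (point x₀) ≡ just γ₀) (x₀-¬B : traceB (point x₀) ≡ nothing)
      (y₀-B : traceB (point y₀) ≡ just β₀) (y₀-¬C : traceC (point y₀) ≡ nothing) where

      x₀≢y₀ : x₀ ≢ y₀
      x₀≢y₀ refl = nothing≢just (trans (sym x₀-¬B) y₀-B)

      off-line⇒base : ∀ z {w₁ w₂} → z ≢ x₀ → z ≢ y₀ → ¬ Col x₀ y₀ z → Collinear (point z) w₁ w₂ →
                      ∃ λ y → point z ≡ base y
      off-line⇒base z z≢x₀ z≢y₀ ¬col (_ , _ , _ , ℓ , oz , _) =
        by-traces (traceB (point z)) refl (traceC (point z)) refl
        where
        by-traces : ∀ mb → traceB (point z) ≡ mb → ∀ mc → traceC (point z) ≡ mc →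
                    ∃ λ y → point z ≡ base y
        by-traces (just _) eb (just _) ec = traced-twice⇒base eb ec
        by-traces nothing eb nothing ec = ⊥-elim ([ any-nothing eb , any-nothing ec ]′ (on-line⇒traced ℓ _ oz))
        by-traces nothing eb (just _) _ = ⊥-elim (¬col (collinear-swap₁₂
          (collinear-through-B-only y₀-B y₀-¬C x₀-¬B eb (point-≢ (z≢x₀ ∘′ sym))
            (proj₂ (third-col y₀ x₀ (x₀≢y₀ ∘′ sym))) (proj₂ (third-col y₀ z (z≢y₀ ∘′ sym))))))
        by-traces (just _) _ nothing ec = ⊥-elim (¬col
          (collinear-through-C-only x₀-C x₀-¬B y₀-¬C ec (point-≢ (z≢y₀ ∘′ sym))
            (proj₂ (third-col x₀ y₀ x₀≢y₀)) (proj₂ (third-col x₀ z (z≢x₀ ∘′ sym)))))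

      -- With s off the line x₀y₀, r on x₀s, t₁ on y₀s and t₂ on y₀r, all of s, r, t₁, t₂ are base points;
      -- then the lines y₀ s t₁ and y₀ r t₂ meet at the B-only point y₀, which forces y₀, s, r collinear.
      impossible : ⊥
      impossible =
        ¬col-y₀sr (base-collinear-through-B-only y₀-B y₀-¬C (proj₂ s-base) (proj₂ t₁-base) (proj₂ r-base)
                    (proj₂ t₂-base) col-t₁ col-t₂ (proj₁ (proj₂ (proj₂ col-r))))
        where
        s-off : Σ (Fin p) λ s → ¬ R-MP P x₀ y₀ s × s ≢ x₀ × s ≢ y₀
        s-off = point-off-line x₀ y₀ x₀≢y₀

        s : Fin p
        s = proj₁ s-off
        ¬col-s : ¬ Col x₀ y₀ s
        ¬col-s c = proj₁ (proj₂ s-off) (col⇒R-MP c)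
        s≢x₀ : s ≢ x₀
        s≢x₀ = proj₁ (proj₂ (proj₂ s-off))
        s≢y₀ : s ≢ y₀
        s≢y₀ = proj₂ (proj₂ (proj₂ s-off))

        r : Fin p
        r = proj₁ (third-col x₀ s (s≢x₀ ∘′ sym))
        col-r : Col x₀ s r
        col-r = proj₂ (third-col x₀ s (s≢x₀ ∘′ sym))
        r≢y₀ : r ≢ y₀
        r≢y₀ e = ¬collinear⇒≢ (¬col-s ∘′ collinear-swap₁₂) col-r (cong point e)
        ¬col-r : ¬ Col x₀ y₀ r
        ¬col-r = ¬collinear-through ¬col-s col-r (point-≢ (s≢y₀ ∘′ sym))

        t₁ : Fin p
        t₁ = proj₁ (third-col y₀ s (s≢y₀ ∘′ sym))
        col-t₁ : Col y₀ s t₁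
        col-t₁ = proj₂ (third-col y₀ s (s≢y₀ ∘′ sym))
        ¬col-t₁ : ¬ Col x₀ y₀ t₁
        ¬col-t₁ = ¬collinear-through (¬col-s ∘′ collinear-swap₁₂) col-t₁ (point-≢ (s≢x₀ ∘′ sym))
                  ∘′ collinear-swap₁₂

        t₂ : Fin p
        t₂ = proj₁ (third-col y₀ r (r≢y₀ ∘′ sym))
        col-t₂ : Col y₀ r t₂
        col-t₂ = proj₂ (third-col y₀ r (r≢y₀ ∘′ sym))
        ¬col-t₂ : ¬ Col x₀ y₀ t₂
        ¬col-t₂ = ¬collinear-through (¬col-r ∘′ collinear-swap₁₂) col-t₂ (proj₁ (proj₂ col-r))
                  ∘′ collinear-swap₁₂

        ¬col-y₀sr : ¬ Col y₀ s r
        ¬col-y₀sr = ¬collinear-through (¬col-s ∘′ collinear-swap₁₂ ∘′ collinear-rotate) (collinear-swap₁₂ col-r)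
                                       (point-≢ x₀≢y₀ ∘′ sym)
                    ∘′ collinear-swap₁₂

        ≢y₀ : ∀ {z w} → Col y₀ w z → z ≢ y₀
        ≢y₀ c e = proj₁ (proj₂ c) (cong point (sym e))

        s-base : ∃ λ y → point s ≡ base y
        s-base = off-line⇒base s s≢x₀ s≢y₀ ¬col-s (collinear-swap₁₂ col-t₁)
        r-base : ∃ λ y → point r ≡ base y
        r-base = off-line⇒base r (λ e → proj₁ (proj₂ col-r) (cong point (sym e))) r≢y₀ ¬col-r
                   (collinear-rotate (collinear-rotate col-r))
        t₁-base : ∃ λ y → point t₁ ≡ base y
        t₁-base = off-line⇒base t₁ (¬collinear⇒≢ ¬col-s col-t₁ ∘′ cong point) (≢y₀ col-t₁) ¬col-t₁
                    (collinear-rotate (collinear-rotate col-t₁))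
        t₂-base : ∃ λ y → point t₂ ≡ base y
        t₂-base = off-line⇒base t₂ (¬collinear⇒≢ ¬col-r col-t₂ ∘′ cong point) (≢y₀ col-t₂) ¬col-t₂
                    (collinear-rotate (collinear-rotate col-t₂))

    traced-B? : ∀ x → Dec (Is-just (traceB (point x)))
    traced-B? x = is-just? (traceB (point x))

    traced-C? : ∀ x → Dec (Is-just (traceC (point x)))
    traced-C? x = is-just? (traceC (point x))

    no-copy : Omits P B → Omits P C → ⊥
    no-copy B-omits C-omits with all? traced-B? | all? traced-C?
    ... | yes all-B | _ = B-omits (all-traced⇒copy sideB EB.into EB.into-R (λ _ → refl) all-B)
    ... | no _ | yes all-C = C-omits (all-traced⇒copy sideC EC.into EC.into-R (λ _ → refl) all-C)
    ... | no ¬all-B | no ¬all-C with ¬∀⟶∃¬ p _ traced-B? ¬all-B | ¬∀⟶∃¬ p _ traced-C? ¬all-C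
    ... | x₀ , x₀∉B | y₀ , y₀∉C =
      StraddlingCopy.impossible (proj₂ (just-other (point-traced x₀) x₀∉B)) (¬is-just⇒nothing x₀∉B)
                                (proj₂ (just-other (swap (point-traced y₀)) y₀∉C)) (¬is-just⇒nothing y₀∉C)

-- The Fraïssé properties

omits-amalgamation : ∀ {p l} (P : ProjectivePlane p l) → AP (Omits P)
omits-amalgamation P A B C _ B-omits C-omits f f-emb g g-emb =
  _ , D , (λ (F , F-inj , F-R) → CopyInD.no-copy P F F-inj F-R B-omits C-omits) ,
  EB.into , EC.into , EB.into-embedding , EC.into-embedding , into-commutes
  where open Amalgam A B C f f-emb g g-emb

empty : ∧Matroid 0
empty = record
  { R = λ () ; meet = λ () ; irrefl = λ () ; sym₁₂ = λ () ; sym₂₃ = λ ()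
  ; exch = λ () ; meet-spec = λ () }

empty-embedding : ∀ {n} (N : ∧Matroid n) → IsEmbedding empty N (λ ())
empty-embedding N = record { injective = λ { {()} } ; pres-R = λ () ; pres-meet = λ () }

empty-omits : ∀ {p l} (P : ProjectivePlane p l) → Omits P empty
empty-omits P (F , _) with F (proj₁ (quad P) zero)
... | ()

omits-jointEmbedding : ∀ {p l} (P : ProjectivePlane p l) → JEP (Omits P)
omits-jointEmbedding P A B A-omits B-omits
  with omits-amalgamation P empty A B (empty-omits P) A-omits B-omits
         (λ ()) (empty-embedding A) (λ ()) (empty-embedding B)
... | _ , D , D-omits , f , g , f-emb , g-emb , _ = _ , D , D-omits , (f , f-emb) , (g , g-emb)

lemma3p4 : ∀ {p l : ℕ} (P : ProjectivePlane p l) →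
    FraisseClass (λ N → Omits P N)
lemma3p4 P = record
  { iso-closed = omits-isoClosed P
  ; sub-closed = omits-substructureClosed P
  ; jep        = omits-jointEmbedding P
  ; ap         = omits-amalgamation P
  }
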